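{- Let $G$ be a distance-regular graph of order $n$ with distance eigenvalues $\partial_1,\dots,\partial_n$. Then the distance Seidel eigenvalues of the Cartesian product $G\times K_2$ are $-1-4\partial_r$ for $r=1,\dots,n$ (each once), $2n-1$ (once), and $-1$ with multiplicity $n-1$.
   Context: The distance eigenvalues of a connected graph are the eigenvalues of its distance matrix $\mathcal{D}(G)=(d_G(v_r,v_t))$. The distance Seidel matrix is $\mathcal{D}^S(G)=J-I-2\mathcal{D}(G)$ ($J$ all-ones), with eigenvalues called distance Seidel eigenvalues. The Cartesian product $G_1\times G_2$ has vertex set $V(G_1)\times V(G_2)$, with $(v_1,u_1)\sim(v_2,u_2)$ iff ($v_1=v_2$ and $u_1u_2\in E(G_2)$) or ($u_1=u_2$ and $v_1v_2\in E(G_1)$). A connected graph is distance-regular if for all vertices $x,y$ with $d(x,y)=i$, the numbers of neighbours of $y$ at distance $i-1$, $i$, $i+1$ from $x$ depend only on $i$. -}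

module Defs where

open import Level using (Level)
open import Data.Nat as ℕ using (ℕ; zero; suc)
open import Data.Bool using (Bool; true; false; _∧_; _∨_; not; if_then_else_; T?)
open import Data.Fin as Fin using (Fin; zero; suc; toℕ; punchIn; remQuot)
open import Data.Fin.Properties using (_≟_)
open import Data.List using (List; length; filter)
open import Data.List using (allFin)
open import Data.Product using (_×_; _,_; proj₁; proj₂; ∃)
open import Data.Sum using (_⊎_)
open import Relation.Nullary using (¬_; does)
open import Relation.Binary.PropositionalEquality using (_≡_)
open import Algebra.Bundles using (CommutativeRing)

record Graph (n : ℕ) : Set where
  field
    adj     : Fin n → Fin n → Bool
    symm    : ∀ u v → adj u v ≡ adj v u
    irrefl  : ∀ u → adj u u ≡ false
open Graph public

data Walk {n : ℕ} (G : Graph n) : Fin n → Fin n → ℕ → Set where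
  here : ∀ u → Walk G u u 0
  step : ∀ {u w v k} → adj G u w ≡ true → Walk G w v k → Walk G u v (suc k)

Connected : ∀ {n} → Graph n → Set
Connected G = ∀ u v → ∃ λ k → Walk G u v k

IsDistance : ∀ {n} → Graph n → Fin n → Fin n → ℕ → Set
IsDistance G u v k = Walk G u v k × (∀ j → j ℕ.< k → ¬ Walk G u v j)

IsDistanceFn : ∀ {n} → Graph n → (Fin n → Fin n → ℕ) → Set
IsDistanceFn G d = ∀ u v → IsDistance G u v (d u v)

count : ∀ {n} → (Fin n → Bool) → ℕ
count {n} p = length (filter (λ z → T? (p z)) (allFin n))

-- intersection numbers relative to (x , y), i = d(x,y):
-- c = #{z ~ y : d(x,z) = i-1}, a = #{z ~ y : d(x,z) = i}, b = #{z ~ y : d(x,z) = i+1}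
cNum aNum bNum : ∀ {n} → Graph n → (Fin n → Fin n → ℕ) → Fin n → Fin n → ℕ
cNum G d x y = count (λ z → adj G y z ∧ (suc (d x z) ℕ.≡ᵇ d x y))
aNum G d x y = count (λ z → adj G y z ∧ (d x z ℕ.≡ᵇ d x y))
bNum G d x y = count (λ z → adj G y z ∧ (d x z ℕ.≡ᵇ suc (d x y)))

-- distance-regular (connectedness is required separately)
DistanceRegular : ∀ {n} → Graph n → (Fin n → Fin n → ℕ) → Set
DistanceRegular G d =
  ∀ x y x' y' → d x y ≡ d x' y' →
    (cNum G d x y ≡ cNum G d x' y') × (aNum G d x y ≡ aNum G d x' y')
      × (bNum G d x y ≡ bNum G d x' y')

-- K₂ and the Cartesian product (vertex (v,u) ↦ combine v u : Fin (n * m))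

eqᵇ : ∀ {n} → Fin n → Fin n → Bool
eqᵇ i j = does (i ≟ j)

K₂ : Graph 2
K₂ = record { adj = adj' ; symm = sy ; irrefl = ir }
  where
  adj' : Fin 2 → Fin 2 → Bool
  adj' i j = not (eqᵇ i j)
  sy : ∀ u v → adj' u v ≡ adj' v u
  sy zero zero = Relation.Binary.PropositionalEquality.refl
  sy zero (suc zero) = Relation.Binary.PropositionalEquality.refl
  sy (suc zero) zero = Relation.Binary.PropositionalEquality.refl
  sy (suc zero) (suc zero) = Relation.Binary.PropositionalEquality.refl
  ir : ∀ u → adj' u u ≡ false
  ir zero = Relation.Binary.PropositionalEquality.refl
  ir (suc zero) = Relation.Binary.PropositionalEquality.refl

_□_ : ∀ {n m} → Graph n → Graph m → Graph (n ℕ.* m)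
_□_ {n} {m} G H = record { adj = A ; symm = sy ; irrefl = ir }
  where
  open Relation.Binary.PropositionalEquality
  A' : Fin n × Fin m → Fin n × Fin m → Bool
  A' (v₁ , u₁) (v₂ , u₂) = (eqᵇ v₁ v₂ ∧ adj H u₁ u₂) ∨ (eqᵇ u₁ u₂ ∧ adj G v₁ v₂)
  A : Fin (n ℕ.* m) → Fin (n ℕ.* m) → Bool
  A p q = A' (remQuot m p) (remQuot m q)
  eqsym : ∀ {k} (i j : Fin k) → eqᵇ i j ≡ eqᵇ j i
  eqsym i j with i ≟ j | j ≟ i
  ... | Relation.Nullary.yes _ | Relation.Nullary.yes _ = refl
  ... | Relation.Nullary.no _ | Relation.Nullary.no _ = refl
  ... | Relation.Nullary.yes e | Relation.Nullary.no ne = Data.Empty.⊥-elim (ne (sym e))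
    where import Data.Empty
  ... | Relation.Nullary.no ne | Relation.Nullary.yes e = Data.Empty.⊥-elim (ne (sym e))
    where import Data.Empty
  sy' : ∀ a b → A' a b ≡ A' b a
  sy' (v₁ , u₁) (v₂ , u₂) =
    cong₂ _∨_ (cong₂ _∧_ (eqsym v₁ v₂) (symm H u₁ u₂)) (cong₂ _∧_ (eqsym u₁ u₂) (symm G v₁ v₂))
  sy : ∀ p q → A p q ≡ A q p
  sy p q = sy' (remQuot m p) (remQuot m q)
  ir' : ∀ a → A' a a ≡ false
  ir' (v , u) rewrite irrefl H u | irrefl G v =
    cong₂ _∨_ (Data.Bool.Properties.∧-zeroʳ (eqᵇ v v)) (Data.Bool.Properties.∧-zeroʳ (eqᵇ u u))
    where import Data.Bool.Properties
  ir : ∀ p → A p p ≡ false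
  ir p = ir' (remQuot m p)

module LinAlg {c ℓ : Level} (R : CommutativeRing c ℓ) where
  open CommutativeRing R using (Carrier; _≈_; _+_; _*_; -_; _-_; 0#; 1#)

  Matrix : ℕ → Set c
  Matrix n = Fin n → Fin n → Carrier

  fromℕ : ℕ → Carrier
  fromℕ zero    = 0#
  fromℕ (suc k) = 1# + fromℕ k

  Σ : ∀ {n} → (Fin n → Carrier) → Carrier
  Σ {zero}  f = 0#
  Σ {suc n} f = f zero + Σ (λ i → f (suc i))

  Π : ∀ {n} → (Fin n → Carrier) → Carrier
  Π {zero}  f = 1#
  Π {suc n} f = f zero * Π (λ i → f (suc i))

  _^_ : Carrier → ℕ → Carrier
  x ^ zero  = 1#
  x ^ suc k = x * (x ^ k)

  sign : ℕ → Carrier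
  sign zero    = 1#
  sign (suc k) = - sign k

  det : ∀ {n} → Matrix n → Carrier
  det {zero}  M = 1#
  det {suc n} M = Σ (λ j → sign (toℕ j) * (M zero j * det (λ r s → M (suc r) (punchIn j s))))

  charPoly : ∀ {n} → Matrix n → Carrier → Carrier
  charPoly M x = det (λ i j → (if eqᵇ i j then x else 0#) - M i j)

  distMatrix : ∀ {n} → (Fin n → Fin n → ℕ) → Matrix n
  distMatrix d i j = fromℕ (d i j)

  distSeidel : ∀ {n} → (Fin n → Fin n → ℕ) → Matrix n
  distSeidel d i j = ((if eqᵇ i j then 0# else 1#) - fromℕ 2 * fromℕ (d i j))

  -- the eigenvalues (with multiplicity) of M are λ₁,…,λₙ :
  -- χ_M(x) = ∏ (x − λᵣ)
  HasEigenvalues : ∀ {n} → Matrix n → (Fin n → Carrier) → Set (c Level.⊔ ℓ)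
  HasEigenvalues M λs = ∀ x → charPoly M x ≈ Π (λ r → x - λs r)

  IsCharZeroDomain : Set (c Level.⊔ ℓ)
  IsCharZeroDomain =
    (¬ (1# ≈ 0#)) × (∀ a b → a * b ≈ 0# → (a ≈ 0#) ⊎ (b ≈ 0#))
      × (∀ k → ¬ (fromℕ (suc k) ≈ 0#))

-- Write the vertices of G □ K₂ as pairs (v , u) with u ∈ {0, 1}. Since
-- d((v,u),(w,u′)) = d(v,w) + [u ≠ u′], the matrix xI − S(G □ K₂) consists of
-- 2 × 2 blocks [[a, b], [b, a]], where A = (a_vw) = xI − S(G) and B = J + 2D(G).
-- Replacing, in every pair, the two columns and then the two rows by their sum
-- and difference makes it block diagonal with blocks 2(A + B) and 2(A − B); in a
-- domain the resulting factor 4ⁿ cancels, and the characteristic polynomial is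
-- det((x+1)I + 4D) · det((x+1)I − 2J). The second factor is (x+1)ⁿ⁻¹(x+1−2n).
-- The first is ∏ᵣ (x+1+4∂ᵣ): both sides are polynomials of degree n in x that
-- agree at the n + 1 distinct points x + 1 = −4k, where, after scaling by −4,
-- the hypothesis on the eigenvalues of D applies.

module Submission where

open import Defs
open import Level using (Level)
open import Data.Nat as ℕ using (ℕ; zero; suc; _≤_; _∸_; z≤n; s≤s)
import Data.Nat.Properties as ℕ
open import Data.Nat.Tactic.RingSolver using (solve-∀)
open import Data.Integer as ℤ using (ℤ; +_; -[1+_])
import Data.Integer.Properties as ℤ
open import Data.Sign as Sign using (Sign)
open import Data.Fin using (Fin; zero; suc; toℕ; fromℕ<; punchIn; punchOut; inject₁; combine; remQuot; quotient; remainder)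
import Data.Fin.Properties as Fin
open import Data.Bool using (Bool; true; false; _∧_; _∨_; if_then_else_)
import Data.Bool.Properties as Bool
open import Data.Maybe using (Maybe; just; nothing)
open import Data.Vec using (Vec; []; _∷_; zipWith; map)
open import Data.Product using (_×_; _,_; proj₁; proj₂; Σ-syntax)
open import Relation.Nullary using (¬_; yes; no)
open import Data.Sum using (_⊎_; inj₁; inj₂)
open import Data.Empty using (⊥-elim)
open import Function using (_∘_; case_of_)
open import Relation.Binary.PropositionalEquality as ≡ using (_≡_; _≢_)
open import Algebra.Bundles using (CommutativeRing)
open import Algebra.Solver.Ring.AlmostCommutativeRing using (fromCommutativeRing; _-Raw-AlmostCommutative⟶_)

punchIn-inject₁-self : ∀ {k} (p : Fin k) → punchIn (inject₁ p) p ≡ suc p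
punchIn-inject₁-self zero    = ≡.refl
punchIn-inject₁-self (suc p) = ≡.cong suc (punchIn-inject₁-self p)

punchIn-suc-self : ∀ {k} (p : Fin k) → punchIn (suc p) p ≡ inject₁ p
punchIn-suc-self zero    = ≡.refl
punchIn-suc-self (suc p) = ≡.cong suc (punchIn-suc-self p)

punchIn-inject₁≡punchIn-suc : ∀ {k} {p s : Fin k} → s ≢ p → punchIn (inject₁ p) s ≡ punchIn (suc p) s
punchIn-inject₁≡punchIn-suc {p = zero}  {zero}  s≢p = ⊥-elim (s≢p ≡.refl)
punchIn-inject₁≡punchIn-suc {p = zero}  {suc s} s≢p = ≡.refl
punchIn-inject₁≡punchIn-suc {p = suc p} {zero}  s≢p = ≡.refl
punchIn-inject₁≡punchIn-suc {p = suc p} {suc s} s≢p = ≡.cong suc (punchIn-inject₁≡punchIn-suc (s≢p ∘ ≡.cong suc))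

punchIn-adjacent : ∀ {k} (j : Fin (suc (suc k))) (p : Fin (suc k)) → j ≢ inject₁ p → j ≢ suc p →
  Σ[ p′ ∈ Fin k ] (punchIn j (inject₁ p′) ≡ inject₁ p × punchIn j (suc p′) ≡ suc p)
punchIn-adjacent zero             zero    j≢p j≢p+1 = ⊥-elim (j≢p ≡.refl)
punchIn-adjacent zero             (suc p) j≢p j≢p+1 = p , ≡.refl , ≡.refl
punchIn-adjacent (suc zero)       zero    j≢p j≢p+1 = ⊥-elim (j≢p+1 ≡.refl)
punchIn-adjacent {suc k} (suc (suc j)) zero j≢p j≢p+1 = zero , ≡.refl , ≡.refl
punchIn-adjacent {suc k} (suc j)  (suc p) j≢p j≢p+1
  with p′ , atLeft , atRight ← punchIn-adjacent j p (j≢p ∘ ≡.cong suc) (j≢p+1 ∘ ≡.cong suc)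
  = suc p′ , ≡.cong suc atLeft , ≡.cong suc atRight

inject₁≢suc : ∀ {m} (p : Fin m) → inject₁ p ≢ suc p
inject₁≢suc zero    ()
inject₁≢suc (suc p) eq = inject₁≢suc p (Fin.suc-injective eq)

copy₀ copy₁ : ∀ {n} → Fin n → Fin (n ℕ.* 2)
copy₀ v = combine v zero
copy₁ v = combine v (suc zero)

quotient-combine : ∀ {n} (w : Fin n) (u : Fin 2) → quotient {n} 2 (combine w u) ≡ w
quotient-combine {n} w u = ≡.cong proj₁ (Fin.remQuot-combine {n} {2} w u)

remainder-combine : ∀ {n} (w : Fin n) (u : Fin 2) → remainder {n} 2 (combine w u) ≡ u
remainder-combine {n} w u = ≡.cong proj₂ (Fin.remQuot-combine {n} {2} w u)

pairStart : ∀ {n} → Fin (suc n) → Fin (suc (n ℕ.* 2))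
pairStart         zero    = zero
pairStart {suc n} (suc w) = suc (suc (pairStart w))

inject₁-pairStart : ∀ {n} (w : Fin (suc n)) → inject₁ (pairStart w) ≡ copy₀ w
inject₁-pairStart         zero    = ≡.refl
inject₁-pairStart {suc n} (suc w) = ≡.cong (λ k → suc (suc k)) (inject₁-pairStart w)

suc-pairStart : ∀ {n} (w : Fin (suc n)) → suc (pairStart w) ≡ copy₁ w
suc-pairStart         zero    = ≡.refl
suc-pairStart {suc n} (suc w) = ≡.cong (λ k → suc (suc k)) (suc-pairStart w)

quotient≡⇒pair : ∀ {n} (j : Fin (n ℕ.* 2)) {w : Fin n} → quotient {n} 2 j ≡ w → j ≡ copy₀ w ⊎ j ≡ copy₁ w
quotient≡⇒pair {n} j ≡.refl with remainder {n} 2 j | Fin.combine-remQuot {n} 2 j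
... | zero     | j≡ = inj₁ (≡.sym j≡)
... | suc zero | j≡ = inj₂ (≡.sym j≡)

-- Shuffles

data Shuffle : ℕ → ℕ → ℕ → Set where
  done  : Shuffle 0 0 0
  left  : ∀ {a b s} → Shuffle a b s → Shuffle (suc a) b (suc s)
  right : ∀ {a b s} → Shuffle a b s → Shuffle a (suc b) (suc s)

embedˡ : ∀ {a b s} → Shuffle a b s → Fin a → Fin s
embedˡ (left σ)  zero    = zero
embedˡ (left σ)  (suc i) = suc (embedˡ σ i)
embedˡ (right σ) i       = suc (embedˡ σ i)

embedʳ : ∀ {a b s} → Shuffle a b s → Fin b → Fin s
embedʳ (left σ)  i       = suc (embedʳ σ i)
embedʳ (right σ) zero    = zero
embedʳ (right σ) (suc i) = suc (embedʳ σ i)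

-- The number of pairs (left element, right element) with the right one first;
-- (-1) ^ inversions σ is the sign of the permutation that lists the left elements first.
inversions : ∀ {a b s} → Shuffle a b s → ℕ
inversions done            = 0
inversions (left σ)        = inversions σ
inversions (right {a} σ)   = a ℕ.+ inversions σ

deleteˡ : ∀ {a b s} → Shuffle (suc a) b (suc s) → Fin (suc a) → Shuffle a b s
deleteˡ (left σ)                zero          = σ
deleteˡ (left σ@(left _))       (suc j)       = left (deleteˡ σ j)
deleteˡ (left σ@(right _))      (suc j@zero)    = left (deleteˡ σ j)
deleteˡ (left σ@(right _))      (suc j@(suc _)) = left (deleteˡ σ j)
deleteˡ (right σ@(left _))      j             = right (deleteˡ σ j)
deleteˡ (right σ@(right _))     j             = right (deleteˡ σ j)

deleteʳ : ∀ {a b s} → Shuffle a (suc b) (suc s) → Fin (suc b) → Shuffle a b s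
deleteʳ (right σ)               zero          = σ
deleteʳ (right σ@(right _))     (suc j)       = right (deleteʳ σ j)
deleteʳ (right σ@(left _))      (suc j@zero)    = right (deleteʳ σ j)
deleteʳ (right σ@(left _))      (suc j@(suc _)) = right (deleteʳ σ j)
deleteʳ (left σ@(left _))       j             = left (deleteʳ σ j)
deleteʳ (left σ@(right _))      j             = left (deleteʳ σ j)

punchIn-deleteˡ-embedˡ : ∀ {a b s} (σ : Shuffle (suc a) b (suc s)) j i →
  punchIn (embedˡ σ j) (embedˡ (deleteˡ σ j) i) ≡ embedˡ σ (punchIn j i)
punchIn-deleteˡ-embedˡ (left σ)                zero            i       = ≡.refl
punchIn-deleteˡ-embedˡ (left (left σ))         (suc j)         zero    = ≡.refl
punchIn-deleteˡ-embedˡ (left (left σ))         (suc j)         (suc i) = ≡.cong suc (punchIn-deleteˡ-embedˡ (left σ) j i)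
punchIn-deleteˡ-embedˡ (left (right σ))        (suc j@zero)    zero    = ≡.refl
punchIn-deleteˡ-embedˡ (left (right σ))        (suc j@(suc _)) zero    = ≡.refl
punchIn-deleteˡ-embedˡ (left (right σ))        (suc j@zero)    (suc i) = ≡.cong suc (punchIn-deleteˡ-embedˡ (right σ) j i)
punchIn-deleteˡ-embedˡ (left (right σ))        (suc j@(suc _)) (suc i) = ≡.cong suc (punchIn-deleteˡ-embedˡ (right σ) j i)
punchIn-deleteˡ-embedˡ (right (left σ))        j               i       = ≡.cong suc (punchIn-deleteˡ-embedˡ (left σ) j i)
punchIn-deleteˡ-embedˡ (right (right σ))       j               i       = ≡.cong suc (punchIn-deleteˡ-embedˡ (right σ) j i)

punchIn-deleteˡ-embedʳ : ∀ {a b s} (σ : Shuffle (suc a) b (suc s)) j i →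
  punchIn (embedˡ σ j) (embedʳ (deleteˡ σ j) i) ≡ embedʳ σ i
punchIn-deleteˡ-embedʳ (left σ)          zero            i       = ≡.refl
punchIn-deleteˡ-embedʳ (left (left σ))   (suc j)         i       = ≡.cong suc (punchIn-deleteˡ-embedʳ (left σ) j i)
punchIn-deleteˡ-embedʳ (left (right σ))  (suc j@zero)    i       = ≡.cong suc (punchIn-deleteˡ-embedʳ (right σ) j i)
punchIn-deleteˡ-embedʳ (left (right σ))  (suc j@(suc _)) i       = ≡.cong suc (punchIn-deleteˡ-embedʳ (right σ) j i)
punchIn-deleteˡ-embedʳ (right (left σ))  j               zero    = ≡.refl
punchIn-deleteˡ-embedʳ (right (left σ))  j               (suc i) = ≡.cong suc (punchIn-deleteˡ-embedʳ (left σ) j i)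
punchIn-deleteˡ-embedʳ (right (right σ)) j               zero    = ≡.refl
punchIn-deleteˡ-embedʳ (right (right σ)) j               (suc i) = ≡.cong suc (punchIn-deleteˡ-embedʳ (right σ) j i)

punchIn-deleteʳ-embedˡ : ∀ {a b s} (σ : Shuffle a (suc b) (suc s)) j i →
  punchIn (embedʳ σ j) (embedˡ (deleteʳ σ j) i) ≡ embedˡ σ i
punchIn-deleteʳ-embedˡ (right σ)         zero            i       = ≡.refl
punchIn-deleteʳ-embedˡ (right (left σ))  (suc j@zero)    i       = ≡.cong suc (punchIn-deleteʳ-embedˡ (left σ) j i)
punchIn-deleteʳ-embedˡ (right (left σ))  (suc j@(suc _)) i       = ≡.cong suc (punchIn-deleteʳ-embedˡ (left σ) j i)
punchIn-deleteʳ-embedˡ (right (right σ)) (suc j)         i       = ≡.cong suc (punchIn-deleteʳ-embedˡ (right σ) j i)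
punchIn-deleteʳ-embedˡ (left (left σ))   j               zero    = ≡.refl
punchIn-deleteʳ-embedˡ (left (left σ))   j               (suc i) = ≡.cong suc (punchIn-deleteʳ-embedˡ (left σ) j i)
punchIn-deleteʳ-embedˡ (left (right σ))  j               zero    = ≡.refl
punchIn-deleteʳ-embedˡ (left (right σ))  j               (suc i) = ≡.cong suc (punchIn-deleteʳ-embedˡ (right σ) j i)

punchIn-deleteʳ-embedʳ : ∀ {a b s} (σ : Shuffle a (suc b) (suc s)) j i →
  punchIn (embedʳ σ j) (embedʳ (deleteʳ σ j) i) ≡ embedʳ σ (punchIn j i)
punchIn-deleteʳ-embedʳ (right σ)         zero            i       = ≡.refl
punchIn-deleteʳ-embedʳ (right (left σ))  (suc j@zero)    zero    = ≡.refl
punchIn-deleteʳ-embedʳ (right (left σ))  (suc j@(suc _)) zero    = ≡.refl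
punchIn-deleteʳ-embedʳ (right (left σ))  (suc j@zero)    (suc i) = ≡.cong suc (punchIn-deleteʳ-embedʳ (left σ) j i)
punchIn-deleteʳ-embedʳ (right (left σ))  (suc j@(suc _)) (suc i) = ≡.cong suc (punchIn-deleteʳ-embedʳ (left σ) j i)
punchIn-deleteʳ-embedʳ (right (right σ)) (suc j)         zero    = ≡.refl
punchIn-deleteʳ-embedʳ (right (right σ)) (suc j)         (suc i) = ≡.cong suc (punchIn-deleteʳ-embedʳ (right σ) j i)
punchIn-deleteʳ-embedʳ (left (left σ))   j               i       = ≡.cong suc (punchIn-deleteʳ-embedʳ (left σ) j i)
punchIn-deleteʳ-embedʳ (left (right σ))  j               i       = ≡.cong suc (punchIn-deleteʳ-embedʳ (right σ) j i)

private
  step-past : ∀ a p d j i → p ℕ.+ d ≡ j ℕ.+ i → suc p ℕ.+ (a ℕ.+ d) ≡ j ℕ.+ (suc a ℕ.+ i)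
  step-past a p d j i eq = ≡.trans (rotate a p d) (≡.trans (≡.cong (suc a ℕ.+_) eq) (rotate′ a j i))
    where
    rotate : ∀ a p d → suc p ℕ.+ (a ℕ.+ d) ≡ suc a ℕ.+ (p ℕ.+ d)
    rotate = solve-∀
    rotate′ : ∀ a j i → suc a ℕ.+ (j ℕ.+ i) ≡ j ℕ.+ (suc a ℕ.+ i)
    rotate′ = solve-∀

embedˡ-inversions-deleteˡ : ∀ {a b s} (σ : Shuffle (suc a) b (suc s)) j →
  toℕ (embedˡ σ j) ℕ.+ inversions (deleteˡ σ j) ≡ toℕ j ℕ.+ inversions σ
embedˡ-inversions-deleteˡ (left σ)         zero            = ≡.refl
embedˡ-inversions-deleteˡ (left (left σ))  (suc j)         = ≡.cong suc (embedˡ-inversions-deleteˡ (left σ) j)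
embedˡ-inversions-deleteˡ (left (right σ)) (suc j@zero)    = ≡.cong suc (embedˡ-inversions-deleteˡ (right σ) j)
embedˡ-inversions-deleteˡ (left (right σ)) (suc j@(suc _)) = ≡.cong suc (embedˡ-inversions-deleteˡ (right σ) j)
embedˡ-inversions-deleteˡ (right {suc a} σ@(left _))  j =
  step-past a (toℕ (embedˡ σ j)) (inversions (deleteˡ σ j)) (toℕ j) (inversions σ) (embedˡ-inversions-deleteˡ σ j)
embedˡ-inversions-deleteˡ (right {suc a} σ@(right _)) j =
  step-past a (toℕ (embedˡ σ j)) (inversions (deleteˡ σ j)) (toℕ j) (inversions σ) (embedˡ-inversions-deleteˡ σ j)

private
  step-pastʳ : ∀ a p i j d → p ℕ.+ i ≡ j ℕ.+ a ℕ.+ d → suc p ℕ.+ (a ℕ.+ i) ≡ suc j ℕ.+ a ℕ.+ (a ℕ.+ d)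
  step-pastʳ a p i j d eq = ≡.trans (rotate a p i) (≡.trans (≡.cong (λ k → suc (a ℕ.+ k)) eq) (rotate′ a j d))
    where
    rotate : ∀ a p i → suc p ℕ.+ (a ℕ.+ i) ≡ suc (a ℕ.+ (p ℕ.+ i))
    rotate = solve-∀
    rotate′ : ∀ a j d → suc (a ℕ.+ (j ℕ.+ a ℕ.+ d)) ≡ suc j ℕ.+ a ℕ.+ (a ℕ.+ d)
    rotate′ = solve-∀

  suc-middle : ∀ j a d → suc (j ℕ.+ a ℕ.+ d) ≡ j ℕ.+ suc a ℕ.+ d
  suc-middle = solve-∀

embedʳ-inversions-deleteʳ : ∀ {a b s} (σ : Shuffle a (suc b) (suc s)) j →
  toℕ (embedʳ σ j) ℕ.+ inversions σ ≡ toℕ j ℕ.+ a ℕ.+ inversions (deleteʳ σ j)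
embedʳ-inversions-deleteʳ (right σ) zero = ≡.refl
embedʳ-inversions-deleteʳ (right {a} σ@(right _)) (suc j) =
  step-pastʳ a (toℕ (embedʳ σ j)) (inversions σ) (toℕ j) (inversions (deleteʳ σ j)) (embedʳ-inversions-deleteʳ σ j)
embedʳ-inversions-deleteʳ (right {a} σ@(left _)) (suc j@zero) =
  step-pastʳ a (toℕ (embedʳ σ j)) (inversions σ) (toℕ j) (inversions (deleteʳ σ j)) (embedʳ-inversions-deleteʳ σ j)
embedʳ-inversions-deleteʳ (right {a} σ@(left _)) (suc j@(suc _)) =
  step-pastʳ a (toℕ (embedʳ σ j)) (inversions σ) (toℕ j) (inversions (deleteʳ σ j)) (embedʳ-inversions-deleteʳ σ j)
embedʳ-inversions-deleteʳ (left {a} σ@(left _)) j =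
  ≡.trans (≡.cong suc (embedʳ-inversions-deleteʳ σ j)) (suc-middle (toℕ j) a _)
embedʳ-inversions-deleteʳ (left {a} σ@(right _)) j =
  ≡.trans (≡.cong suc (embedʳ-inversions-deleteʳ σ j)) (suc-middle (toℕ j) a _)

interleave : ∀ n → Shuffle n n (n ℕ.* 2)
interleave zero    = done
interleave (suc n) = left (right (interleave n))

embedˡ-interleave : ∀ n (v : Fin n) → embedˡ (interleave n) v ≡ copy₀ v
embedˡ-interleave (suc n) zero    = ≡.refl
embedˡ-interleave (suc n) (suc v) = ≡.cong (λ k → suc (suc k)) (embedˡ-interleave n v)

embedʳ-interleave : ∀ n (v : Fin n) → embedʳ (interleave n) v ≡ copy₁ v
embedʳ-interleave (suc n) zero    = ≡.refl
embedʳ-interleave (suc n) (suc v) = ≡.cong (λ k → suc (suc k)) (embedʳ-interleave n v)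

-- Distances in G □ K₂

eqᵇ-refl : ∀ {n} (i : Fin n) → eqᵇ i i ≡ true
eqᵇ-refl i with i Fin.≟ i
... | yes _   = ≡.refl
... | no  i≢i = ⊥-elim (i≢i ≡.refl)

eqᵇ-true : ∀ {n} {i j : Fin n} → eqᵇ i j ≡ true → i ≡ j
eqᵇ-true {i = i} {j} eq with i Fin.≟ j
... | yes i≡j = i≡j

eqᵇ-≢ : ∀ {n} {i j : Fin n} → i ≢ j → eqᵇ i j ≡ false
eqᵇ-≢ {i = i} {j} i≢j with i Fin.≟ j
... | yes i≡j = ⊥-elim (i≢j i≡j)
... | no  _   = ≡.refl

eqᵇ-combine : ∀ {n} (v w : Fin n) (u u′ : Fin 2) → eqᵇ (combine v u) (combine w u′) ≡ (eqᵇ v w ∧ eqᵇ u u′)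
eqᵇ-combine v w u u′ with v Fin.≟ w | u Fin.≟ u′
... | yes ≡.refl | yes ≡.refl = eqᵇ-refl (combine v u)
... | yes ≡.refl | no  u≢u′   = eqᵇ-≢ (u≢u′ ∘ proj₂ ∘ Fin.combine-injective v u v u′)
... | no  v≢w    | _          = eqᵇ-≢ (v≢w ∘ proj₁ ∘ Fin.combine-injective v u w u′)

crossing : Fin 2 → Fin 2 → ℕ
crossing u u′ = if eqᵇ u u′ then 0 else 1

crossing-refl : ∀ u → crossing u u ≡ 0
crossing-refl u rewrite eqᵇ-refl u = ≡.refl

crossing≤1 : ∀ u u′ → crossing u u′ ≤ 1
crossing≤1 u u′ with eqᵇ u u′
... | true  = z≤n
... | false = s≤s z≤n

module _ {n} (G : Graph n) where

  layer : Fin (n ℕ.* 2) → Fin 2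
  layer p = remainder {n} 2 p

  adjacency : Fin n × Fin 2 → Fin n × Fin 2 → Bool
  adjacency (v , u) (w , u′) = (eqᵇ v w ∧ adj K₂ u u′) ∨ (eqᵇ u u′ ∧ adj G v w)

  adj-□K₂ : ∀ v u w u′ → adj (G □ K₂) (combine v u) (combine w u′) ≡ adjacency (v , u) (w , u′)
  adj-□K₂ v u w u′ = ≡.cong₂ adjacency (Fin.remQuot-combine {n} {2} v u) (Fin.remQuot-combine {n} {2} w u′)

  edge-□K₂ : ∀ x y → adjacency x y ≡ true → proj₁ x ≡ proj₁ y ⊎ (proj₂ x ≡ proj₂ y × adj G (proj₁ x) (proj₁ y) ≡ true)
  edge-□K₂ (v , u) (w , u′) e with eqᵇ v w in v≡w | eqᵇ u u′ in u≡u′ | adj G v w in vw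
  ... | true  | _     | _    = inj₁ (eqᵇ-true v≡w)
  ... | false | true  | true = inj₂ (eqᵇ-true u≡u′ , ≡.refl)

  projectWalk : ∀ {p q k} → Walk (G □ K₂) p q k →
    Σ[ g ∈ ℕ ] (Walk G (quotient 2 p) (quotient 2 q) g × g ℕ.+ crossing (layer p) (layer q) ≤ k)
  projectWalk {p} (here .p) = 0 , here _ , ℕ.≤-reflexive (crossing-refl (layer p))
  projectWalk {p} {q} (step {w = r} {k = k} e walk) with projectWalk walk | edge-□K₂ (remQuot {n} 2 p) (remQuot {n} 2 r) e
  ... | g , walk′ , g+c≤k | inj₁ sameVertex =
    g , ≡.subst (λ z → Walk G z (quotient 2 q) g) (≡.sym sameVertex) walk′ ,
    ℕ.≤-trans (ℕ.+-monoʳ-≤ g (crossing≤1 (layer p) (layer q)))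
              (ℕ.≤-trans (ℕ.≤-reflexive (ℕ.+-comm g 1)) (s≤s (ℕ.≤-trans (ℕ.m≤m+n g _) g+c≤k)))
  ... | g , walk′ , g+c≤k | inj₂ (sameLayer , edge) =
    suc g , step edge walk′ , s≤s (≡.subst (λ z → g ℕ.+ crossing z (layer q) ≤ k) (≡.sym sameLayer) g+c≤k)

  liftWalk : ∀ {v w k} u → Walk G v w k → Walk (G □ K₂) (combine v u) (combine w u) k
  liftWalk u (here v) = here (combine v u)
  liftWalk {v} u (step {w = r} e walk) = step edge (liftWalk u walk)
    where
    edge : adj (G □ K₂) (combine v u) (combine r u) ≡ true
    edge rewrite adj-□K₂ v u r u | eqᵇ-refl u | e = Bool.∨-zeroʳ _

  cross : ∀ v u u′ → u ≢ u′ → adj (G □ K₂) (combine v u) (combine v u′) ≡ true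
  cross v u u′ u≢u′ rewrite adj-□K₂ v u v u′ | eqᵇ-refl v | eqᵇ-≢ u≢u′ = ≡.refl

  distance≤walk : ∀ {d} → IsDistanceFn G d → ∀ {v w g} → Walk G v w g → d v w ≤ g
  distance≤walk {d} isDistance {v} {w} {g} walk with ℕ.≤-<-connex (d v w) g
  ... | inj₁ d≤g = d≤g
  ... | inj₂ g<d = ⊥-elim (proj₂ (isDistance v w) g g<d walk)

  distance-□K₂ : ∀ {d dP} → IsDistanceFn G d → IsDistanceFn (G □ K₂) dP →
    ∀ v u w u′ → dP (combine v u) (combine w u′) ≡ d v w ℕ.+ crossing u u′
  distance-□K₂ {d} {dP} isDistance isDistanceP v u w u′ = ℕ.≤-antisym upper lower
    where
    p q : Fin (n ℕ.* 2)
    p = combine v u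
    q = combine w u′
    lower : d v w ℕ.+ crossing u u′ ≤ dP p q
    lower with g , walk , g+c≤dP ← projectWalk (proj₁ (isDistanceP p q)) =
      ℕ.≤-trans (ℕ.+-mono-≤ (distance≤walk isDistance (≡.subst₂ (λ a b → Walk G a b g) (quotient-combine v u) (quotient-combine w u′) walk))
                            (ℕ.≤-reflexive (≡.sym (≡.cong₂ crossing (remainder-combine v u) (remainder-combine w u′)))))
                g+c≤dP
    walk : Walk (G □ K₂) p q (d v w ℕ.+ crossing u u′)
    walk with u Fin.≟ u′
    ... | yes ≡.refl = ≡.subst (Walk (G □ K₂) p q) (≡.sym (ℕ.+-identityʳ _)) (liftWalk u (proj₁ (isDistance v w)))
    ... | no  u≢u′ = ≡.subst (Walk (G □ K₂) p q) (ℕ.+-comm 1 (d v w))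
                       (step (cross v u u′ u≢u′) (liftWalk u′ (proj₁ (isDistance v w))))
    upper : dP p q ≤ d v w ℕ.+ crossing u u′
    upper with ℕ.≤-<-connex (dP p q) (d v w ℕ.+ crossing u u′)
    ... | inj₁ dP≤ = dP≤
    ... | inj₂ <dP = ⊥-elim (proj₂ (isDistanceP p q) _ <dP walk)

module Determinant {c ℓ} (R : CommutativeRing c ℓ) where

  open CommutativeRing R hiding (zero)
  open LinAlg R
  open import Relation.Binary.Reasoning.Setoid setoid
  open import Algebra.Properties.Ring ring using (-1*x≈-x; -‿involutive; -0#≈0#; -‿+-comm; -‿distribˡ-*; x∙y⁻¹≈ε⇒x≈y; +-cancelˡ; -‿injective)

  -- fromℕ 1 is 1# + 0#, not 1#; the solver's constants are interpreted through
  -- ℕ→R instead, so that a solver constant 1 is definitionally 1#.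
  ℕ→R : ℕ → Carrier
  ℕ→R zero          = 0#
  ℕ→R (suc zero)    = 1#
  ℕ→R (suc (suc n)) = 1# + ℕ→R (suc n)

  ℕ→R-suc : ∀ n → ℕ→R (suc n) ≈ 1# + ℕ→R n
  ℕ→R-suc zero    = sym (+-identityʳ 1#)
  ℕ→R-suc (suc n) = refl

  ℕ→R≈fromℕ : ∀ n → ℕ→R n ≈ fromℕ n
  ℕ→R≈fromℕ zero    = refl
  ℕ→R≈fromℕ (suc n) = trans (ℕ→R-suc n) (+-congˡ (ℕ→R≈fromℕ n))

  ℕ→R-+ : ∀ m n → ℕ→R (m ℕ.+ n) ≈ ℕ→R m + ℕ→R n
  ℕ→R-+ zero    n = sym (+-identityˡ _)
  ℕ→R-+ (suc m) n = begin
    ℕ→R (suc (m ℕ.+ n))       ≈⟨ ℕ→R-suc (m ℕ.+ n) ⟩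
    1# + ℕ→R (m ℕ.+ n)        ≈⟨ +-congˡ (ℕ→R-+ m n) ⟩
    1# + (ℕ→R m + ℕ→R n)      ≈⟨ +-assoc _ _ _ ⟨
    (1# + ℕ→R m) + ℕ→R n      ≈⟨ +-congʳ (ℕ→R-suc m) ⟨
    ℕ→R (suc m) + ℕ→R n       ∎

  ℕ→R-* : ∀ m n → ℕ→R (m ℕ.* n) ≈ ℕ→R m * ℕ→R n
  ℕ→R-* zero    n = sym (zeroˡ _)
  ℕ→R-* (suc m) n = begin
    ℕ→R (n ℕ.+ m ℕ.* n)           ≈⟨ ℕ→R-+ n (m ℕ.* n) ⟩
    ℕ→R n + ℕ→R (m ℕ.* n)         ≈⟨ +-cong (sym (*-identityˡ _)) (ℕ→R-* m n) ⟩
    1# * ℕ→R n + ℕ→R m * ℕ→R n    ≈⟨ distribʳ _ _ _ ⟨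
    (1# + ℕ→R m) * ℕ→R n          ≈⟨ *-congʳ (ℕ→R-suc m) ⟨
    ℕ→R (suc m) * ℕ→R n           ∎

  signᴿ : Sign → Carrier
  signᴿ Sign.+ = 1#
  signᴿ Sign.- = - 1#

  fromℤ : ℤ → Carrier
  fromℤ (+ n)    = ℕ→R n
  fromℤ -[1+ n ] = - ℕ→R (suc n)

  signᴿ-* : ∀ s t → signᴿ (s Sign.* t) ≈ signᴿ s * signᴿ t
  signᴿ-* Sign.- Sign.- = sym (trans (-1*x≈-x _) (-‿involutive _))
  signᴿ-* Sign.- Sign.+ = sym (*-identityʳ _)
  signᴿ-* Sign.+ t      = sym (*-identityˡ _)

  fromℤ-◃ : ∀ s n → fromℤ (s ℤ.◃ n) ≈ signᴿ s * ℕ→R n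
  fromℤ-◃ s      zero    = sym (zeroʳ _)
  fromℤ-◃ Sign.+ (suc n) = sym (*-identityˡ _)
  fromℤ-◃ Sign.- (suc n) = sym (-1*x≈-x _)

  fromℤ-signAbs : ∀ i → fromℤ i ≈ signᴿ (ℤ.sign i) * ℕ→R ℤ.∣ i ∣
  fromℤ-signAbs i = trans (reflexive (≡.cong fromℤ (≡.sym (ℤ.◃-inverse i)))) (fromℤ-◃ (ℤ.sign i) ℤ.∣ i ∣)

  1+x-[1+y]≈x-y : ∀ x y → (1# + x) - (1# + y) ≈ x - y
  1+x-[1+y]≈x-y x y = begin
    (1# + x) - (1# + y)     ≈⟨ +-cong (+-comm 1# x) (sym (-‿+-comm 1# y)) ⟩
    (x + 1#) + (- 1# - y)   ≈⟨ +-assoc x 1# _ ⟩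
    x + (1# + (- 1# - y))   ≈⟨ +-congˡ (sym (+-assoc 1# (- 1#) _)) ⟩
    x + ((1# - 1#) - y)     ≈⟨ +-congˡ (+-congʳ (-‿inverseʳ 1#)) ⟩
    x + (0# - y)            ≈⟨ +-congˡ (+-identityˡ _) ⟩
    x - y                   ∎

  fromℤ-⊖ : ∀ m n → fromℤ (m ℤ.⊖ n) ≈ ℕ→R m - ℕ→R n
  fromℤ-⊖ zero    zero    = sym (-‿inverseʳ 0#)
  fromℤ-⊖ zero    (suc n) = sym (+-identityˡ _)
  fromℤ-⊖ (suc m) zero    = sym (trans (+-congˡ -0#≈0#) (+-identityʳ _))
  fromℤ-⊖ (suc m) (suc n) = begin
    fromℤ (suc m ℤ.⊖ suc n)         ≡⟨ ≡.cong fromℤ (ℤ.[1+m]⊖[1+n]≡m⊖n m n) ⟩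
    fromℤ (m ℤ.⊖ n)                 ≈⟨ fromℤ-⊖ m n ⟩
    ℕ→R m - ℕ→R n                   ≈⟨ 1+x-[1+y]≈x-y _ _ ⟨
    (1# + ℕ→R m) - (1# + ℕ→R n)     ≈⟨ +-cong (ℕ→R-suc m) (-‿cong (ℕ→R-suc n)) ⟨
    ℕ→R (suc m) - ℕ→R (suc n)       ∎

  fromℤ-+ : ∀ i j → fromℤ (i ℤ.+ j) ≈ fromℤ i + fromℤ j
  fromℤ-+ -[1+ m ] -[1+ n ] = begin
    - ℕ→R (suc (suc m ℕ.+ n))           ≡⟨ ≡.cong (λ k → - ℕ→R (suc k)) (ℕ.+-suc m n) ⟨
    - ℕ→R (suc m ℕ.+ suc n)             ≈⟨ -‿cong (ℕ→R-+ (suc m) (suc n)) ⟩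
    - (ℕ→R (suc m) + ℕ→R (suc n))     ≈⟨ -‿+-comm _ _ ⟨
    - ℕ→R (suc m) + - ℕ→R (suc n)     ∎
  fromℤ-+ -[1+ m ] (+ n)    = trans (fromℤ-⊖ n (suc m)) (+-comm _ _)
  fromℤ-+ (+ m)    -[1+ n ] = fromℤ-⊖ m (suc n)
  fromℤ-+ (+ m)    (+ n)    = ℕ→R-+ m n

  fromℤ-* : ∀ i j → fromℤ (i ℤ.* j) ≈ fromℤ i * fromℤ j
  fromℤ-* i j = begin
    fromℤ (s Sign.* t ℤ.◃ a ℕ.* b)          ≈⟨ fromℤ-◃ (s Sign.* t) (a ℕ.* b) ⟩
    signᴿ (s Sign.* t) * ℕ→R (a ℕ.* b)    ≈⟨ *-cong (signᴿ-* s t) (ℕ→R-* a b) ⟩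
    (signᴿ s * signᴿ t) * (ℕ→R a * ℕ→R b) ≈⟨ interchange _ _ _ _ ⟩
    (signᴿ s * ℕ→R a) * (signᴿ t * ℕ→R b) ≈⟨ *-cong (fromℤ-signAbs i) (fromℤ-signAbs j) ⟨
    fromℤ i * fromℤ j                        ∎
    where
    open import Algebra.Properties.CommutativeSemigroup *-commutativeSemigroup using (interchange)
    s t : Sign
    s = ℤ.sign i
    t = ℤ.sign j
    a b : ℕ
    a = ℤ.∣ i ∣
    b = ℤ.∣ j ∣

  fromℤ-neg : ∀ i → fromℤ (ℤ.- i) ≈ - fromℤ i
  fromℤ-neg -[1+ n ]     = sym (-‿involutive _)
  fromℤ-neg (+ zero)     = sym -0#≈0#
  fromℤ-neg (+ (suc n))  = refl

  fromℤ-homomorphism : ℤ.+-*-rawRing -Raw-AlmostCommutative⟶ fromCommutativeRing R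
  fromℤ-homomorphism = record
    { ⟦_⟧ = fromℤ ; +-homo = fromℤ-+ ; *-homo = fromℤ-* ; -‿homo = fromℤ-neg
    ; 0-homo = refl ; 1-homo = refl }

  fromℤ-≟ : ∀ i j → Maybe (fromℤ i ≈ fromℤ j)
  fromℤ-≟ i j with i ℤ.≟ j
  ... | yes ≡.refl = just refl
  ... | no _       = nothing

  open import Algebra.Solver.Ring ℤ.+-*-rawRing (fromCommutativeRing R) fromℤ-homomorphism fromℤ-≟
    public using (Polynomial; solve; _:=_; _:+_; _:*_; _:-_; :-_; con)

  ‵fromℕ : ∀ {m} → ℕ → Polynomial m
  ‵fromℕ zero    = con (+ 0)
  ‵fromℕ (suc k) = con (+ 1) :+ ‵fromℕ k

  -- Opaque copies of Σ and det: the transparent ones unfold on Fin (suc n)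
  -- during unification, which blocks inference of summands and matrices.
  opaque
    ∑ : ∀ {n} → (Fin n → Carrier) → Carrier
    ∑ = Σ

  opaque
    unfolding ∑

    ∑-suc : ∀ {n} (f : Fin (suc n) → Carrier) → ∑ f ≈ f zero + ∑ (λ i → f (suc i))
    ∑-suc f = refl

    ∑-cong : ∀ {n} {f g : Fin n → Carrier} → (∀ i → f i ≈ g i) → ∑ f ≈ ∑ g
    ∑-cong {zero}  f≈g = refl
    ∑-cong {suc n} f≈g = +-cong (f≈g zero) (∑-cong (λ i → f≈g (suc i)))

    ∑-+ : ∀ {n} (f g : Fin n → Carrier) → ∑ (λ i → f i + g i) ≈ ∑ f + ∑ g
    ∑-+ {zero}  f g = sym (+-identityʳ 0#)
    ∑-+ {suc n} f g = trans (+-congˡ (∑-+ (λ i → f (suc i)) (λ i → g (suc i))))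
      (solve 4 (λ a b c d → (a :+ b) :+ (c :+ d) := (a :+ c) :+ (b :+ d)) refl
        (f zero) (g zero) (∑ (λ i → f (suc i))) (∑ (λ i → g (suc i))))

    ∑-*ˡ : ∀ {n} a (f : Fin n → Carrier) → ∑ (λ i → a * f i) ≈ a * ∑ f
    ∑-*ˡ {zero}  a f = sym (zeroʳ a)
    ∑-*ˡ {suc n} a f = trans (+-congˡ (∑-*ˡ a (λ i → f (suc i)))) (sym (distribˡ _ _ _))

    ∑-zero : ∀ {n} {f : Fin n → Carrier} → (∀ i → f i ≈ 0#) → ∑ f ≈ 0#
    ∑-zero {zero}  f≈0 = refl
    ∑-zero {suc n} f≈0 = trans (+-cong (f≈0 zero) (∑-zero (λ i → f≈0 (suc i)))) (+-identityʳ 0#)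

    ∑-const : ∀ n a → ∑ {n} (λ _ → a) ≈ fromℕ n * a
    ∑-const zero    a = sym (zeroˡ a)
    ∑-const (suc n) a = trans (+-cong (sym (*-identityˡ a)) (∑-const n a)) (sym (distribʳ a 1# (fromℕ n)))

    ∑-comm : ∀ {m n} (f : Fin m → Fin n → Carrier) → ∑ (λ i → ∑ (λ j → f i j)) ≈ ∑ (λ j → ∑ (λ i → f i j))
    ∑-comm {zero} {n} f = sym (∑-zero {n} (λ _ → refl))
    ∑-comm {suc m} f = trans (+-congˡ (∑-comm (λ i → f (suc i)))) (sym (∑-+ (f zero) _))

    ∑-punchIn : ∀ {n} (f : Fin (suc n) → Carrier) p → ∑ f ≈ f p + ∑ (λ i → f (punchIn p i))
    ∑-punchIn         f zero    = refl
    ∑-punchIn {suc n} f (suc p) = trans (+-congˡ (∑-punchIn (λ i → f (suc i)) p))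
      (solve 3 (λ a b c → a :+ (b :+ c) := b :+ (a :+ c)) refl (f zero) (f (suc p)) _)

  ∑-neg : ∀ {n} (f : Fin n → Carrier) → ∑ (λ i → - f i) ≈ - ∑ f
  ∑-neg f = begin
    ∑ (λ i → - f i)        ≈⟨ ∑-cong (λ i → -1*x≈-x (f i)) ⟨
    ∑ (λ i → - 1# * f i)   ≈⟨ ∑-*ˡ (- 1#) f ⟩
    - 1# * ∑ f             ≈⟨ -1*x≈-x (∑ f) ⟩
    - ∑ f                  ∎

  Π-cong : ∀ {n} {f g : Fin n → Carrier} → (∀ i → f i ≈ g i) → Π f ≈ Π g
  Π-cong {zero}  f≈g = refl
  Π-cong {suc n} f≈g = *-cong (f≈g zero) (Π-cong (λ i → f≈g (suc i)))

  ^-cong : ∀ {x y} n → x ≈ y → x ^ n ≈ y ^ n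
  ^-cong zero    x≈y = refl
  ^-cong (suc n) x≈y = *-cong x≈y (^-cong n x≈y)

  ^-distrib-* : ∀ x y n → (x * y) ^ n ≈ (x ^ n) * (y ^ n)
  ^-distrib-* x y zero    = sym (*-identityˡ 1#)
  ^-distrib-* x y (suc n) = trans (*-congˡ (^-distrib-* x y n))
    (solve 4 (λ x y a b → (x :* y) :* (a :* b) := (x :* a) :* (y :* b)) refl x y (x ^ n) (y ^ n))

  Π-*ˡ : ∀ {n} t (f : Fin n → Carrier) → Π (λ r → t * f r) ≈ (t ^ n) * Π f
  Π-*ˡ {zero}  t f = sym (*-identityˡ 1#)
  Π-*ˡ {suc n} t f = trans (*-congˡ (Π-*ˡ t (λ r → f (suc r))))
    (solve 4 (λ t a u p → (t :* a) :* (u :* p) := (t :* u) :* (a :* p)) refl t (f zero) (t ^ n) _)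

  sgn : ∀ {n} → Fin n → Carrier
  sgn j = sign (toℕ j)

  sign² : ∀ n → sign n * sign n ≈ 1#
  sign² zero    = *-identityˡ 1#
  sign² (suc n) = trans (solve 1 (λ x → (:- x) :* (:- x) := x :* x) refl (sign n)) (sign² n)

  _ᵀ : ∀ {n} → Matrix n → Matrix n
  (M ᵀ) i j = M j i

  minor : ∀ {n} → Matrix (suc n) → Fin (suc n) → Matrix n
  minor M j r s = M (suc r) (punchIn j s)

  doubleMinor : ∀ {k} → Matrix (suc (suc k)) → Fin (suc k) → Fin (suc k) → Matrix k
  doubleMinor M i j r s = M (suc (punchIn i r)) (suc (punchIn j s))

  laplaceTerm : ∀ {n} → (Matrix n → Carrier) → Matrix (suc n) → Fin (suc n) → Carrier
  laplaceTerm D M j = sgn j * (M zero j * D (minor M j))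

  opaque
    unfolding ∑

    Det : ∀ {n} → Matrix n → Carrier
    Det = det

    Det≡det : ∀ {n} (M : Matrix n) → Det M ≡ det M
    Det≡det M = ≡.refl

    Det-zero : (M : Matrix 0) → Det M ≈ 1#
    Det-zero M = refl

    Det-suc : ∀ {n} (M : Matrix (suc n)) → Det M ≈ ∑ (laplaceTerm Det M)
    Det-suc M = refl

  Det-cong : ∀ {n} {M N : Matrix n} → (∀ i j → M i j ≈ N i j) → Det M ≈ Det N
  Det-cong {zero}  {M} {N} M≈N = trans (Det-zero M) (sym (Det-zero N))
  Det-cong {suc n} {M} {N} M≈N = begin
    Det M ≈⟨ Det-suc M ⟩
    ∑ (λ j → sgn j * (M zero j * Det (minor M j)))
      ≈⟨ ∑-cong (λ j → *-congˡ (*-cong (M≈N zero j) (Det-cong (λ r s → M≈N (suc r) (punchIn j s))))) ⟩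
    ∑ (λ j → sgn j * (N zero j * Det (minor N j))) ≈⟨ Det-suc N ⟨
    Det N ∎

  Det₁ : (M : Matrix 1) → Det M ≈ M zero zero
  Det₁ M = begin
    Det M                                            ≈⟨ Det-suc M ⟩
    ∑ (λ j → sgn j * (M zero j * Det (minor M j)))   ≈⟨ ∑-suc _ ⟩
    1# * (M zero zero * Det (minor M zero)) + ∑ {0} _ ≈⟨ +-cong (*-identityˡ _) (∑-zero (λ ())) ⟩
    M zero zero * Det (minor M zero) + 0#            ≈⟨ +-identityʳ _ ⟩
    M zero zero * Det (minor M zero)                 ≈⟨ *-congˡ (Det-zero _) ⟩
    M zero zero * 1#                                 ≈⟨ *-identityʳ _ ⟩
    M zero zero                                      ∎

  Det-expand-row-column : ∀ {k} (M : Matrix (suc (suc k))) →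
    (∀ (N : Matrix (suc k)) → Det (N ᵀ) ≈ Det N) → (∀ (N : Matrix k) → Det (N ᵀ) ≈ Det N) →
    Det M ≈ M zero zero * Det (minor M zero)
            - ∑ (λ i → ∑ (λ j → (sgn i * M (suc i) zero) * (sgn j * M zero (suc j)) * Det (doubleMinor M i j)))
  Det-expand-row-column M transpose₁ transpose₀ = begin
    Det M ≈⟨ trans (Det-suc M) (∑-suc _) ⟩
    1# * (M zero zero * Det (minor M zero)) + ∑ (λ j → (- sgn j) * (M zero (suc j) * Det (minor M (suc j))))
      ≈⟨ +-cong (*-identityˡ _) (∑-cong column) ⟩
    M zero zero * Det (minor M zero) + ∑ (λ j → - ∑ (λ i → g i j))
      ≈⟨ +-congˡ (trans (∑-neg _) (-‿cong (∑-comm (λ j i → g i j)))) ⟩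
    M zero zero * Det (minor M zero) - ∑ (λ i → ∑ (λ j → g i j)) ∎
    where
    g : Fin _ → Fin _ → Carrier
    g i j = (sgn i * M (suc i) zero) * (sgn j * M zero (suc j)) * Det (doubleMinor M i j)
    column : ∀ j → (- sgn j) * (M zero (suc j) * Det (minor M (suc j))) ≈ - ∑ (λ i → g i j)
    column j = begin
      (- sgn j) * (M zero (suc j) * Det (minor M (suc j)))
        ≈⟨ *-congˡ (*-congˡ (trans (sym (transpose₁ (minor M (suc j)))) (Det-suc _))) ⟩
      (- sgn j) * (M zero (suc j) * ∑ (λ i → sgn i * (M (suc i) zero * Det (doubleMinor M i j ᵀ))))
        ≈⟨ sym (*-assoc _ _ _) ⟩
      ((- sgn j) * M zero (suc j)) * ∑ (λ i → sgn i * (M (suc i) zero * Det (doubleMinor M i j ᵀ)))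
        ≈⟨ ∑-*ˡ _ _ ⟨
      ∑ (λ i → ((- sgn j) * M zero (suc j)) * (sgn i * (M (suc i) zero * Det (doubleMinor M i j ᵀ))))
        ≈⟨ ∑-cong (λ i → *-congˡ (*-congˡ (*-congˡ (transpose₀ (doubleMinor M i j))))) ⟩
      ∑ (λ i → ((- sgn j) * M zero (suc j)) * (sgn i * (M (suc i) zero * Det (doubleMinor M i j))))
        ≈⟨ ∑-cong (λ i → solve 5 (λ s a t b d → ((:- s) :* a) :* (t :* (b :* d)) := :- ((t :* b) :* (s :* a) :* d))
                                   refl (sgn j) (M zero (suc j)) (sgn i) (M (suc i) zero) (Det (doubleMinor M i j))) ⟩
      ∑ (λ i → - g i j) ≈⟨ ∑-neg _ ⟩
      - ∑ (λ i → g i j) ∎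

  Det-transpose : ∀ {n} (M : Matrix n) → Det (M ᵀ) ≈ Det M
  Det-transpose {zero}        M = trans (Det-zero _) (sym (Det-zero M))
  Det-transpose {suc zero}    M = trans (Det₁ (M ᵀ)) (sym (Det₁ M))
  Det-transpose {suc (suc k)} M = begin
    Det (M ᵀ) ≈⟨ Det-expand-row-column (M ᵀ) Det-transpose Det-transpose ⟩
    M zero zero * Det (minor (M ᵀ) zero) - ∑ (λ i → ∑ (λ j → gᵀ i j))
      ≈⟨ +-cong (*-congˡ (Det-transpose (minor M zero)))
                (-‿cong (trans (∑-cong (λ i → ∑-cong (swap i))) (∑-comm (λ i j → g j i)))) ⟩
    M zero zero * Det (minor M zero) - ∑ (λ i → ∑ (λ j → g i j))
      ≈⟨ Det-expand-row-column M Det-transpose Det-transpose ⟨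
    Det M ∎
    where
    g gᵀ : Fin (suc k) → Fin (suc k) → Carrier
    g i j = (sgn i * M (suc i) zero) * (sgn j * M zero (suc j)) * Det (doubleMinor M i j)
    gᵀ i j = (sgn i * M zero (suc i)) * (sgn j * M (suc j) zero) * Det (doubleMinor (M ᵀ) i j)
    swap : ∀ i j → gᵀ i j ≈ g j i
    swap i j = *-cong (*-comm _ _) (Det-transpose (doubleMinor M j i))

  Det-linear-column : ∀ {n} (M₁ M₂ M : Matrix n) c a b →
    (∀ i j → j ≢ c → M i j ≈ M₁ i j) → (∀ i j → j ≢ c → M i j ≈ M₂ i j) →
    (∀ i → M i c ≈ a * M₁ i c + b * M₂ i c) → Det M ≈ a * Det M₁ + b * Det M₂
  Det-linear-column {suc n} M₁ M₂ M c a b agree₁ agree₂ column = begin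
    Det M                                                      ≈⟨ Det-suc M ⟩
    ∑ (laplaceTerm Det M)                                      ≈⟨ ∑-cong term ⟩
    ∑ (λ j → a * laplaceTerm Det M₁ j + b * laplaceTerm Det M₂ j) ≈⟨ ∑-+ _ _ ⟩
    ∑ (λ j → a * laplaceTerm Det M₁ j) + ∑ (λ j → b * laplaceTerm Det M₂ j)
      ≈⟨ +-cong (trans (∑-*ˡ a _) (*-congˡ (sym (Det-suc M₁)))) (trans (∑-*ˡ b _) (*-congˡ (sym (Det-suc M₂)))) ⟩
    a * Det M₁ + b * Det M₂                                    ∎
    where
    term : ∀ j → laplaceTerm Det M j ≈ a * laplaceTerm Det M₁ j + b * laplaceTerm Det M₂ j
    term j with j Fin.≟ c
    ... | yes ≡.refl = begin
      sgn j * (M zero j * Det (minor M j))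
        ≈⟨ *-congˡ (*-congʳ (column zero)) ⟩
      sgn j * ((a * M₁ zero j + b * M₂ zero j) * Det (minor M j))
        ≈⟨ solve 6 (λ s a b x y d → s :* ((a :* x :+ b :* y) :* d) := a :* (s :* (x :* d)) :+ b :* (s :* (y :* d)))
                   refl (sgn j) a b (M₁ zero j) (M₂ zero j) (Det (minor M j)) ⟩
      a * (sgn j * (M₁ zero j * Det (minor M j))) + b * (sgn j * (M₂ zero j * Det (minor M j)))
        ≈⟨ +-cong (*-congˡ (*-congˡ (*-congˡ (minor≈ agree₁)))) (*-congˡ (*-congˡ (*-congˡ (minor≈ agree₂)))) ⟩
      a * laplaceTerm Det M₁ j + b * laplaceTerm Det M₂ j ∎
      where
      minor≈ : ∀ {N} → (∀ i j → j ≢ c → M i j ≈ N i j) → Det (minor M j) ≈ Det (minor N j)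
      minor≈ agree = Det-cong (λ r s → agree (suc r) (punchIn j s) (Fin.punchInᵢ≢i j s))
    ... | no j≢c = begin
      sgn j * (M zero j * Det (minor M j))
        ≈⟨ *-congˡ (*-congˡ minorLinear) ⟩
      sgn j * (M zero j * (a * Det (minor M₁ j) + b * Det (minor M₂ j)))
        ≈⟨ solve 6 (λ s a b x y z → s :* (x :* (a :* y :+ b :* z)) := a :* (s :* (x :* y)) :+ b :* (s :* (x :* z)))
                   refl (sgn j) a b (M zero j) (Det (minor M₁ j)) (Det (minor M₂ j)) ⟩
      a * (sgn j * (M zero j * Det (minor M₁ j))) + b * (sgn j * (M zero j * Det (minor M₂ j)))
        ≈⟨ +-cong (*-congˡ (*-congˡ (*-congʳ (agree₁ zero j j≢c)))) (*-congˡ (*-congˡ (*-congʳ (agree₂ zero j j≢c)))) ⟩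
      a * laplaceTerm Det M₁ j + b * laplaceTerm Det M₂ j ∎
      where
      c′ : Fin n
      c′ = punchOut j≢c
      punchIn-c′ : punchIn j c′ ≡ c
      punchIn-c′ = Fin.punchIn-punchOut j≢c
      off-c′ : ∀ {N} → (∀ i j → j ≢ c → M i j ≈ N i j) → ∀ r s → s ≢ c′ → minor M j r s ≈ minor N j r s
      off-c′ agree r s s≢c′ = agree (suc r) (punchIn j s)
        (λ eq → s≢c′ (Fin.punchIn-injective j s c′ (≡.trans eq (≡.sym punchIn-c′))))
      minorLinear : Det (minor M j) ≈ a * Det (minor M₁ j) + b * Det (minor M₂ j)
      minorLinear = Det-linear-column (minor M₁ j) (minor M₂ j) (minor M j) c′ a b (off-c′ agree₁) (off-c′ agree₂)
        (λ r → ≡.subst (λ k → M (suc r) k ≈ a * M₁ (suc r) k + b * M₂ (suc r) k) (≡.sym punchIn-c′) (column (suc r)))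

  Det-adjacent-equal-columns : ∀ {m} (M : Matrix (suc m)) p →
    (∀ i → M i (inject₁ p) ≈ M i (suc p)) → Det M ≈ 0#
  Det-adjacent-equal-columns {suc m} M p equal = begin
    Det M                                             ≈⟨ Det-suc M ⟩
    ∑ t                                               ≈⟨ ∑-punchIn t (inject₁ p) ⟩
    t (inject₁ p) + ∑ (λ j → t (punchIn (inject₁ p) j)) ≈⟨ +-congˡ (∑-punchIn _ p) ⟩
    t (inject₁ p) + (t (punchIn (inject₁ p) p) + ∑ (λ j → t (punchIn (inject₁ p) (punchIn p j))))
      ≈⟨ +-congˡ (+-cong (reflexive (≡.cong t (punchIn-inject₁-self p))) (∑-zero other)) ⟩
    t (inject₁ p) + (t (suc p) + 0#)                  ≈⟨ +-congˡ (+-identityʳ _) ⟩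
    t (inject₁ p) + t (suc p)                         ≈⟨ pair ⟩
    0#                                                ∎
    where
    t : Fin (suc (suc m)) → Carrier
    t = laplaceTerm Det M
    other : ∀ j → t (punchIn (inject₁ p) (punchIn p j)) ≈ 0#
    other j with punchIn-adjacent (punchIn (inject₁ p) (punchIn p j)) p
                   (Fin.punchInᵢ≢i (inject₁ p) (punchIn p j))
                   (λ eq → Fin.punchInᵢ≢i p j (Fin.punchIn-injective (inject₁ p) _ _
                             (≡.trans eq (≡.sym (punchIn-inject₁-self p)))))
    ... | p′ , atLeft , atRight = begin
      sgn k * (M zero k * Det (minor M k)) ≈⟨ *-congˡ (*-congˡ (Det-adjacent-equal-columns (minor M k) p′ equal′)) ⟩
      sgn k * (M zero k * 0#)             ≈⟨ *-congˡ (zeroʳ _) ⟩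
      sgn k * 0#                          ≈⟨ zeroʳ _ ⟩
      0#                                  ∎
      where
      k : Fin (suc (suc m))
      k = punchIn (inject₁ p) (punchIn p j)
      equal′ : ∀ r → minor M k r (inject₁ p′) ≈ minor M k r (suc p′)
      equal′ r rewrite atLeft | atRight = equal (suc r)
    sameMinor : Det (minor M (inject₁ p)) ≈ Det (minor M (suc p))
    sameMinor = Det-cong entry
      where
      entry : ∀ r s → M (suc r) (punchIn (inject₁ p) s) ≈ M (suc r) (punchIn (suc p) s)
      entry r s with s Fin.≟ p
      ... | yes ≡.refl rewrite punchIn-inject₁-self s | punchIn-suc-self s = sym (equal (suc r))
      ... | no s≢p = reflexive (≡.cong (M (suc r)) (punchIn-inject₁≡punchIn-suc s≢p))
    pair : t (inject₁ p) + t (suc p) ≈ 0#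
    pair = begin
      sgn (inject₁ p) * (M zero (inject₁ p) * Det (minor M (inject₁ p))) + (- sgn p) * (M zero (suc p) * Det (minor M (suc p)))
        ≈⟨ +-congʳ (*-cong (reflexive (≡.cong sign (Fin.toℕ-inject₁ p))) (*-cong (equal zero) sameMinor)) ⟩
      sgn p * x + (- sgn p) * x ≈⟨ solve 2 (λ s x → s :* x :+ (:- s) :* x := con (+ 0)) refl (sgn p) x ⟩
      0# ∎
      where
      x : Carrier
      x = M zero (suc p) * Det (minor M (suc p))

  opaque
    setColumn : ∀ {n} → Matrix n → Fin n → (Fin n → Carrier) → Matrix n
    setColumn M c v i j with j Fin.≟ c
    ... | yes _ = v i
    ... | no  _ = M i j

  opaque
    unfolding setColumn

    setColumn-≡ : ∀ {n} (M : Matrix n) c v i → setColumn M c v i c ≈ v i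
    setColumn-≡ M c v i with c Fin.≟ c
    ... | yes _   = refl
    ... | no  c≢c = ⊥-elim (c≢c ≡.refl)

    setColumn-≢ : ∀ {n} (M : Matrix n) c v i j → j ≢ c → setColumn M c v i j ≈ M i j
    setColumn-≢ M c v i j j≢c with j Fin.≟ c
    ... | yes j≡c = ⊥-elim (j≢c j≡c)
    ... | no  _   = refl

  Det-scale-column : ∀ {n} (M M′ : Matrix n) c t →
    (∀ i j → j ≢ c → M′ i j ≈ M i j) → (∀ i → M′ i c ≈ t * M i c) → Det M′ ≈ t * Det M
  Det-scale-column M M′ c t agree scaled = begin
    Det M′                 ≈⟨ Det-linear-column M M M′ c t 0# agree agree (λ i → trans (scaled i) (sym (t*x+0*x≈t*x t _))) ⟩
    t * Det M + 0# * Det M ≈⟨ t*x+0*x≈t*x t (Det M) ⟩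
    t * Det M              ∎
    where
    t*x+0*x≈t*x : ∀ t x → t * x + 0# * x ≈ t * x
    t*x+0*x≈t*x = solve 2 (λ t x → t :* x :+ con (+ 0) :* x := t :* x) refl

  Det-add-column : ∀ {n} (M M′ : Matrix n) c d t → Det (setColumn M c (λ i → M i d)) ≈ 0# →
    (∀ i j → j ≢ c → M′ i j ≈ M i j) → (∀ i → M′ i c ≈ M i c + t * M i d) → Det M′ ≈ Det M
  Det-add-column M M′ c d t repeated agree added = begin
    Det M′ ≈⟨ Det-linear-column M (setColumn M c (λ i → M i d)) M′ c 1# t agree
                (λ i j j≢c → trans (agree i j j≢c) (sym (setColumn-≢ M c _ i j j≢c)))
                (λ i → trans (added i) (+-cong (sym (*-identityˡ _)) (*-congˡ (sym (setColumn-≡ M c _ i))))) ⟩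
    1# * Det M + t * Det (setColumn M c (λ i → M i d)) ≈⟨ +-cong (*-identityˡ _) (trans (*-congˡ repeated) (zeroʳ t)) ⟩
    Det M + 0#                                          ≈⟨ +-identityʳ _ ⟩
    Det M ∎

  Det-add-next-column : ∀ {m} (M M′ : Matrix (suc m)) p t →
    (∀ i j → j ≢ inject₁ p → M′ i j ≈ M i j) → (∀ i → M′ i (inject₁ p) ≈ M i (inject₁ p) + t * M i (suc p)) →
    Det M′ ≈ Det M
  Det-add-next-column M M′ p t = Det-add-column M M′ (inject₁ p) (suc p) t
    (Det-adjacent-equal-columns _ p (λ i → trans (setColumn-≡ M _ _ i)
      (sym (setColumn-≢ M _ _ i (suc p) (inject₁≢suc p ∘ ≡.sym)))))

  Det-add-previous-column : ∀ {m} (M M′ : Matrix (suc m)) p t →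
    (∀ i j → j ≢ suc p → M′ i j ≈ M i j) → (∀ i → M′ i (suc p) ≈ M i (suc p) + t * M i (inject₁ p)) →
    Det M′ ≈ Det M
  Det-add-previous-column M M′ p t = Det-add-column M M′ (suc p) (inject₁ p) t
    (Det-adjacent-equal-columns _ p (λ i → trans (setColumn-≢ M _ _ i (inject₁ p) (inject₁≢suc p))
      (sym (setColumn-≡ M _ _ i))))

  Det-add-previous-row : ∀ {m} (M M′ : Matrix (suc m)) p t →
    (∀ i j → i ≢ suc p → M′ i j ≈ M i j) → (∀ j → M′ (suc p) j ≈ M (suc p) j + t * M (inject₁ p) j) →
    Det M′ ≈ Det M
  Det-add-previous-row M M′ p t agree added = begin
    Det M′      ≈⟨ Det-transpose M′ ⟨
    Det (M′ ᵀ)  ≈⟨ Det-add-previous-column (M ᵀ) (M′ ᵀ) p t (λ i j → agree j i) added ⟩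
    Det (M ᵀ)   ≈⟨ Det-transpose M ⟩
    Det M       ∎

  Det-*ˡ : ∀ {n} t (M : Matrix n) → Det (λ i j → t * M i j) ≈ (t ^ n) * Det M
  Det-*ˡ {zero}  t M = trans (Det-zero _) (sym (trans (*-identityˡ _) (Det-zero M)))
  Det-*ˡ {suc n} t M = begin
    Det (λ i j → t * M i j)
      ≈⟨ Det-suc _ ⟩
    ∑ (λ j → sgn j * ((t * M zero j) * Det (λ r s → t * minor M j r s)))
      ≈⟨ ∑-cong (λ j → *-congˡ (*-congˡ (Det-*ˡ t (minor M j)))) ⟩
    ∑ (λ j → sgn j * ((t * M zero j) * ((t ^ n) * Det (minor M j))))
      ≈⟨ ∑-cong (λ j → solve 5 (λ s t x u d → s :* ((t :* x) :* (u :* d)) := (t :* u) :* (s :* (x :* d)))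
                                 refl (sgn j) t (M zero j) (t ^ n) (Det (minor M j))) ⟩
    ∑ (λ j → (t * (t ^ n)) * laplaceTerm Det M j)
      ≈⟨ ∑-*ˡ _ _ ⟩
    (t * (t ^ n)) * ∑ (laplaceTerm Det M)
      ≈⟨ *-congˡ (Det-suc M) ⟨
    (t * (t ^ n)) * Det M ∎

  Det-butterfly-adjacent-columns : ∀ {m} (N N′ : Matrix (suc m)) p →
    (∀ i j → j ≢ inject₁ p → j ≢ suc p → N′ i j ≈ N i j) →
    (∀ i → N′ i (inject₁ p) ≈ N i (inject₁ p) + N i (suc p)) →
    (∀ i → N′ i (suc p) ≈ N i (inject₁ p) - N i (suc p)) →
    Det N′ ≈ (- ℕ→R 2) * Det N
  Det-butterfly-adjacent-columns N N′ p agree sum difference = begin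
    Det N′ ≈⟨ Det-cong final ⟩
    Det N₃ ≈⟨ Det-add-previous-column N₂ N₃ p 1# (setColumn-≢ N₂ (suc p) _) (setColumn-≡ N₂ (suc p) _) ⟩
    Det N₂ ≈⟨ Det-scale-column N₁ N₂ (suc p) (- ℕ→R 2) (setColumn-≢ N₁ (suc p) _) (setColumn-≡ N₁ (suc p) _) ⟩
    (- ℕ→R 2) * Det N₁
      ≈⟨ *-congˡ (Det-add-next-column N N₁ p 1# (setColumn-≢ N (inject₁ p) _)
                  (λ i → trans (setColumn-≡ N (inject₁ p) _ i) (+-congˡ (sym (*-identityˡ _))))) ⟩
    (- ℕ→R 2) * Det N ∎
    where
    N₁ N₂ N₃ : Matrix (suc _)
    N₁ = setColumn N (inject₁ p) (λ i → N i (inject₁ p) + N i (suc p))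
    N₂ = setColumn N₁ (suc p) (λ i → (- ℕ→R 2) * N₁ i (suc p))
    N₃ = setColumn N₂ (suc p) (λ i → N₂ i (suc p) + 1# * N₂ i (inject₁ p))
    N₁-sp : ∀ i → N₁ i (suc p) ≈ N i (suc p)
    N₁-sp i = setColumn-≢ N _ _ i (suc p) (inject₁≢suc p ∘ ≡.sym)
    N₂-ip : ∀ i → N₂ i (inject₁ p) ≈ N₁ i (inject₁ p)
    N₂-ip i = setColumn-≢ N₁ _ _ i (inject₁ p) (inject₁≢suc p)
    final : ∀ i j → N′ i j ≈ N₃ i j
    final i j with j Fin.≟ suc p
    ... | yes ≡.refl = begin
      N′ i (suc p)                    ≈⟨ difference i ⟩
      N i (inject₁ p) - N i (suc p)
        ≈⟨ solve 2 (λ a b → a :- b := (:- con (+ 2)) :* b :+ con (+ 1) :* (a :+ b)) refl (N i (inject₁ p)) (N i (suc p)) ⟩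
      (- ℕ→R 2) * N i (suc p) + 1# * (N i (inject₁ p) + N i (suc p))
        ≈⟨ +-cong (trans (setColumn-≡ N₁ _ _ i) (*-congˡ (N₁-sp i)))
                  (*-congˡ (trans (N₂-ip i) (setColumn-≡ N _ _ i))) ⟨
      N₂ i (suc p) + 1# * N₂ i (inject₁ p) ≈⟨ setColumn-≡ N₂ _ _ i ⟨
      N₃ i (suc p)                    ∎
    ... | no j≢sp with j Fin.≟ inject₁ p
    ...   | yes ≡.refl = begin
      N′ i (inject₁ p)                ≈⟨ sum i ⟩
      N i (inject₁ p) + N i (suc p)   ≈⟨ setColumn-≡ N _ _ i ⟨
      N₁ i (inject₁ p)                ≈⟨ N₂-ip i ⟨
      N₂ i (inject₁ p)                ≈⟨ setColumn-≢ N₂ _ _ i (inject₁ p) (inject₁≢suc p) ⟨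
      N₃ i (inject₁ p)                ∎
    ...   | no j≢ip = begin
      N′ i j  ≈⟨ agree i j j≢ip j≢sp ⟩
      N i j   ≈⟨ setColumn-≢ N _ _ i j j≢ip ⟨
      N₁ i j  ≈⟨ setColumn-≢ N₁ _ _ i j j≢sp ⟨
      N₂ i j  ≈⟨ setColumn-≢ N₂ _ _ i j j≢sp ⟨
      N₃ i j  ∎

  opaque
    hybridColumns : ∀ {n} → ℕ → Matrix (n ℕ.* 2) → Matrix (n ℕ.* 2) → Matrix (n ℕ.* 2)
    hybridColumns {n} k M M′ i j with toℕ (quotient {n} 2 j) ℕ.<? k
    ... | yes _ = M′ i j
    ... | no  _ = M i j

  opaque
    unfolding hybridColumns

    hybridColumns-< : ∀ {n} k (M M′ : Matrix (n ℕ.* 2)) i j → toℕ (quotient {n} 2 j) ℕ.< k →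
      hybridColumns {n} k M M′ i j ≈ M′ i j
    hybridColumns-< {n} k M M′ i j q<k with toℕ (quotient {n} 2 j) ℕ.<? k
    ... | yes _   = refl
    ... | no  q≮k = ⊥-elim (q≮k q<k)

    hybridColumns-≮ : ∀ {n} k (M M′ : Matrix (n ℕ.* 2)) i j → ¬ toℕ (quotient {n} 2 j) ℕ.< k →
      hybridColumns {n} k M M′ i j ≈ M i j
    hybridColumns-≮ {n} k M M′ i j q≮k with toℕ (quotient {n} 2 j) ℕ.<? k
    ... | yes q<k = ⊥-elim (q≮k q<k)
    ... | no  _   = refl

  module _ {n} (M M′ : Matrix (suc n ℕ.* 2))
    (sum : ∀ i (w : Fin (suc n)) → M′ i (copy₀ w) ≈ M i (copy₀ w) + M i (copy₁ w))
    (difference : ∀ i (w : Fin (suc n)) → M′ i (copy₁ w) ≈ M i (copy₀ w) - M i (copy₁ w))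
    where

    stage : ℕ → Matrix (suc n ℕ.* 2)
    stage k = hybridColumns {suc n} k M M′

    Det-stage-suc : ∀ w → Det (stage (suc (toℕ w))) ≈ (- ℕ→R 2) * Det (stage (toℕ w))
    Det-stage-suc w =
      Det-butterfly-adjacent-columns (stage k) (stage (suc k)) (pairStart w) off sum′ difference′
      where
      k : ℕ
      k = toℕ w
      new : ∀ u i → stage (suc k) i (combine w u) ≈ M′ i (combine w u)
      new u i = hybridColumns-< (suc k) M M′ i _ (ℕ.≤-reflexive (≡.cong (suc ∘ toℕ) (quotient-combine w u)))
      old : ∀ u i → stage k i (combine w u) ≈ M i (combine w u)
      old u i = hybridColumns-≮ k M M′ i _ (ℕ.<-irrefl (≡.cong toℕ (quotient-combine w u)))
      sum′ : ∀ i → stage (suc k) i (inject₁ (pairStart w)) ≈ stage k i (inject₁ (pairStart w)) + stage k i (suc (pairStart w))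
      sum′ i rewrite inject₁-pairStart w | suc-pairStart w =
        trans (new zero i) (trans (sum i w) (sym (+-cong (old zero i) (old (suc zero) i))))
      difference′ : ∀ i → stage (suc k) i (suc (pairStart w)) ≈ stage k i (inject₁ (pairStart w)) - stage k i (suc (pairStart w))
      difference′ i rewrite inject₁-pairStart w | suc-pairStart w =
        trans (new (suc zero) i) (trans (difference i w) (sym (+-cong (old zero i) (-‿cong (old (suc zero) i)))))
      off : ∀ i j → j ≢ inject₁ (pairStart w) → j ≢ suc (pairStart w) → stage (suc k) i j ≈ stage k i j
      off i j j≢ip j≢sp with toℕ (quotient {suc n} 2 j) ℕ.<? k
      ... | yes q<k = trans (hybridColumns-< (suc k) M M′ i j (ℕ.m<n⇒m<1+n q<k)) (sym (hybridColumns-< k M M′ i j q<k))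
      ... | no  q≮k = trans (hybridColumns-≮ (suc k) M M′ i j q≮1+k) (sym (hybridColumns-≮ k M M′ i j q≮k))
        where
        q≢w : quotient {suc n} 2 j ≢ w
        q≢w q≡w with quotient≡⇒pair j q≡w
        ... | inj₁ j≡ = j≢ip (≡.trans j≡ (≡.sym (inject₁-pairStart w)))
        ... | inj₂ j≡ = j≢sp (≡.trans j≡ (≡.sym (suc-pairStart w)))
        q≮1+k : ¬ toℕ (quotient {suc n} 2 j) ℕ.< suc k
        q≮1+k q<1+k with ℕ.m<1+n⇒m<n∨m≡n q<1+k
        ... | inj₁ q<k = q≮k q<k
        ... | inj₂ q≡k = q≢w (Fin.toℕ-injective q≡k)

    Det-stage : ∀ k → k ℕ.≤ suc n → Det (stage k) ≈ ((- ℕ→R 2) ^ k) * Det (stage 0)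
    Det-stage zero    _       = sym (*-identityˡ _)
    Det-stage (suc k) k<1+n = begin
      Det (stage (suc k))                           ≡⟨ ≡.cong (Det ∘ stage ∘ suc) toℕ-w ⟨
      Det (stage (suc (toℕ w)))                     ≈⟨ Det-stage-suc w ⟩
      (- ℕ→R 2) * Det (stage (toℕ w))               ≡⟨ ≡.cong (λ k → (- ℕ→R 2) * Det (stage k)) toℕ-w ⟩
      (- ℕ→R 2) * Det (stage k)                     ≈⟨ *-congˡ (Det-stage k (ℕ.<⇒≤ k<1+n)) ⟩
      (- ℕ→R 2) * (((- ℕ→R 2) ^ k) * Det (stage 0)) ≈⟨ *-assoc _ _ _ ⟨
      ((- ℕ→R 2) ^ suc k) * Det (stage 0)           ∎
      where
      w : Fin (suc n)
      w = fromℕ< k<1+n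
      toℕ-w : toℕ w ≡ k
      toℕ-w = Fin.toℕ-fromℕ< k<1+n

  Det-butterfly-columns : ∀ n (M M′ : Matrix (n ℕ.* 2)) →
    (∀ i (w : Fin n) → M′ i (copy₀ w) ≈ M i (copy₀ w) + M i (copy₁ w)) →
    (∀ i (w : Fin n) → M′ i (copy₁ w) ≈ M i (copy₀ w) - M i (copy₁ w)) →
    Det M′ ≈ ((- ℕ→R 2) ^ n) * Det M
  Det-butterfly-columns zero    M M′ _   _          = trans (Det-zero M′) (sym (trans (*-identityˡ _) (Det-zero M)))
  Det-butterfly-columns (suc n) M M′ sum difference = begin
    Det M′
      ≈⟨ Det-cong (λ i j → sym (hybridColumns-< (suc n) M M′ i j (Fin.toℕ<n _))) ⟩
    Det (hybridColumns (suc n) M M′)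
      ≈⟨ Det-stage M M′ sum difference (suc n) ℕ.≤-refl ⟩
    ((- ℕ→R 2) ^ suc n) * Det (hybridColumns 0 M M′)
      ≈⟨ *-congˡ (Det-cong (λ i j → hybridColumns-≮ 0 M M′ i j (λ ()))) ⟩
    ((- ℕ→R 2) ^ suc n) * Det M ∎

  Det-butterfly-rows : ∀ n (M M′ : Matrix (n ℕ.* 2)) →
    (∀ j (v : Fin n) → M′ (copy₀ v) j ≈ M (copy₀ v) j + M (copy₁ v) j) →
    (∀ j (v : Fin n) → M′ (copy₁ v) j ≈ M (copy₀ v) j - M (copy₁ v) j) →
    Det M′ ≈ ((- ℕ→R 2) ^ n) * Det M
  Det-butterfly-rows n M M′ sum difference = begin
    Det M′                        ≈⟨ Det-transpose M′ ⟨
    Det (M′ ᵀ)                    ≈⟨ Det-butterfly-columns n (M ᵀ) (M′ ᵀ) sum difference ⟩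
    ((- ℕ→R 2) ^ n) * Det (M ᵀ)   ≈⟨ *-congˡ (Det-transpose M) ⟩
    ((- ℕ→R 2) ^ n) * Det M       ∎

  -- Block-diagonal matrices

  sign-+ : ∀ m n → sign (m ℕ.+ n) ≈ sign m * sign n
  sign-+ zero    n = sym (*-identityˡ _)
  sign-+ (suc m) n = trans (-‿cong (sign-+ m n)) (-‿distribˡ-* _ _)

  shuffleSign : ∀ {a b s} → Shuffle a b s → Carrier
  shuffleSign σ = sign (inversions σ)

  shuffleSign² : ∀ {a b s} (σ : Shuffle a b s) → shuffleSign σ * shuffleSign σ ≈ 1#
  shuffleSign² σ = sign² (inversions σ)

  sgn-embedˡ : ∀ {a b s} (σ : Shuffle (suc a) b (suc s)) j →
    sgn (embedˡ σ j) * shuffleSign (deleteˡ σ j) ≈ sgn j * shuffleSign σ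
  sgn-embedˡ σ j = begin
    sgn (embedˡ σ j) * shuffleSign (deleteˡ σ j)                ≈⟨ sign-+ (toℕ (embedˡ σ j)) (inversions (deleteˡ σ j)) ⟨
    sign (toℕ (embedˡ σ j) ℕ.+ inversions (deleteˡ σ j))       ≡⟨ ≡.cong sign (embedˡ-inversions-deleteˡ σ j) ⟩
    sign (toℕ j ℕ.+ inversions σ)                              ≈⟨ sign-+ (toℕ j) (inversions σ) ⟩
    sgn j * shuffleSign σ                                      ∎

  sgn-embedʳ : ∀ {a b s} (σ : Shuffle a (suc b) (suc s)) j →
    sgn (embedʳ σ j) * shuffleSign (deleteʳ σ j) ≈ sgn j * sign a * shuffleSign σ
  sgn-embedʳ {a} σ j = begin
    P * D                   ≈⟨ trans (*-congˡ (shuffleSign² σ)) (*-identityʳ _) ⟨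
    (P * D) * (I * I)       ≈⟨ solve 3 (λ p d i → (p :* d) :* (i :* i) := (p :* i) :* (d :* i)) refl P D I ⟩
    (P * I) * (D * I)       ≈⟨ *-congʳ inversions-eq ⟩
    (J * A * D) * (D * I)   ≈⟨ solve 4 (λ j a d i → (j :* a :* d) :* (d :* i) := (j :* a :* i) :* (d :* d)) refl J A D I ⟩
    (J * A * I) * (D * D)   ≈⟨ trans (*-congˡ (shuffleSign² (deleteʳ σ j))) (*-identityʳ _) ⟩
    J * A * I               ∎
    where
    P D I J A : Carrier
    P = sgn (embedʳ σ j) ; D = shuffleSign (deleteʳ σ j) ; I = shuffleSign σ ; J = sgn j ; A = sign a
    inversions-eq : P * I ≈ J * A * D
    inversions-eq = begin
      P * I                                                     ≈⟨ sign-+ (toℕ (embedʳ σ j)) (inversions σ) ⟨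
      sign (toℕ (embedʳ σ j) ℕ.+ inversions σ)                  ≡⟨ ≡.cong sign (embedʳ-inversions-deleteʳ σ j) ⟩
      sign (toℕ j ℕ.+ a ℕ.+ inversions (deleteʳ σ j))           ≈⟨ trans (sign-+ (toℕ j ℕ.+ a) _) (*-congʳ (sign-+ (toℕ j) a)) ⟩
      J * A * D                                                 ∎

  ∑-shuffle : ∀ {a b s} (σ : Shuffle a b s) (f : Fin s → Carrier) →
    ∑ f ≈ ∑ (λ i → f (embedˡ σ i)) + ∑ (λ i → f (embedʳ σ i))
  ∑-shuffle done      f = trans (∑-zero (λ ())) (sym (trans (+-cong (∑-zero (λ ())) (∑-zero (λ ()))) (+-identityʳ 0#)))
  ∑-shuffle (left σ)  f = begin
    ∑ f                                                                   ≈⟨ ∑-suc f ⟩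
    f zero + ∑ (λ i → f (suc i))                                          ≈⟨ +-congˡ (∑-shuffle σ (λ i → f (suc i))) ⟩
    f zero + (∑ (λ i → f (suc (embedˡ σ i))) + ∑ (λ i → f (suc (embedʳ σ i)))) ≈⟨ +-assoc _ _ _ ⟨
    (f zero + ∑ (λ i → f (suc (embedˡ σ i)))) + ∑ (λ i → f (suc (embedʳ σ i))) ≈⟨ +-congʳ (∑-suc (λ i → f (embedˡ (left σ) i))) ⟨
    ∑ (λ i → f (embedˡ (left σ) i)) + ∑ (λ i → f (embedʳ (left σ) i))       ∎
  ∑-shuffle (right σ) f = begin
    ∑ f                                                                   ≈⟨ ∑-suc f ⟩
    f zero + ∑ (λ i → f (suc i))                                          ≈⟨ +-congˡ (∑-shuffle σ (λ i → f (suc i))) ⟩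
    f zero + (∑ (λ i → f (suc (embedˡ σ i))) + ∑ (λ i → f (suc (embedʳ σ i))))
      ≈⟨ solve 3 (λ x y z → x :+ (y :+ z) := y :+ (x :+ z)) refl (f zero) _ _ ⟩
    ∑ (λ i → f (suc (embedˡ σ i))) + (f zero + ∑ (λ i → f (suc (embedʳ σ i)))) ≈⟨ +-congˡ (∑-suc (λ i → f (embedʳ (right σ) i))) ⟨
    ∑ (λ i → f (embedˡ (right σ) i)) + ∑ (λ i → f (embedʳ (right σ) i))     ∎

  leftBlock : ∀ {a b s} → Shuffle a b s → Shuffle a b s → Matrix s → Matrix a
  leftBlock ρ κ N i j = N (embedˡ ρ i) (embedˡ κ j)

  rightBlock : ∀ {a b s} → Shuffle a b s → Shuffle a b s → Matrix s → Matrix b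
  rightBlock ρ κ N i j = N (embedʳ ρ i) (embedʳ κ j)

  Det-shuffled-blocks : ∀ {a b s} (ρ κ : Shuffle a b s) (N : Matrix s) →
    (∀ i j → N (embedˡ ρ i) (embedʳ κ j) ≈ 0#) → (∀ i j → N (embedʳ ρ i) (embedˡ κ j) ≈ 0#) →
    Det N ≈ (shuffleSign ρ * shuffleSign κ) * (Det (leftBlock ρ κ N) * Det (rightBlock ρ κ N))
  Det-shuffled-blocks done done N _ _ = begin
    Det N                         ≈⟨ Det-zero N ⟩
    1#                            ≈⟨ solve 0 (con (+ 1) := (con (+ 1) :* con (+ 1)) :* (con (+ 1) :* con (+ 1))) refl ⟩
    (1# * 1#) * (1# * 1#)         ≈⟨ *-congˡ (*-cong (Det-zero _) (Det-zero _)) ⟨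
    (1# * 1#) * (Det (leftBlock done done N) * Det (rightBlock done done N)) ∎
  Det-shuffled-blocks (left ρ) κ N upper lower = begin
    Det N                                          ≈⟨ trans (Det-suc N) (∑-shuffle κ t) ⟩
    ∑ (λ j → t (embedˡ κ j)) + ∑ (λ j → t (embedʳ κ j)) ≈⟨ +-cong (∑-cong leftColumn) (∑-zero rightColumn) ⟩
    ∑ (λ j → w * laplaceTerm Det X j) + 0#         ≈⟨ trans (+-identityʳ _) (∑-*ˡ w _) ⟩
    w * ∑ (laplaceTerm Det X)                      ≈⟨ *-congˡ (Det-suc X) ⟨
    w * Det X                                      ≈⟨ solve 4 (λ p k y x → p :* k :* y :* x := p :* k :* (x :* y)) refl _ _ (Det Y) (Det X) ⟩
    (shuffleSign ρ * shuffleSign κ) * (Det X * Det Y) ∎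
    where
    X : Matrix _
    X = leftBlock (left ρ) κ N
    Y : Matrix _
    Y = rightBlock (left ρ) κ N
    w : Carrier
    w = shuffleSign ρ * shuffleSign κ * Det Y
    t : Fin _ → Carrier
    t = laplaceTerm Det N
    rightColumn : ∀ j → t (embedʳ κ j) ≈ 0#
    rightColumn j = trans (*-congˡ (trans (*-congʳ (upper zero j)) (zeroˡ _))) (zeroʳ _)
    leftColumn : ∀ j → t (embedˡ κ j) ≈ w * laplaceTerm Det X j
    leftColumn j = begin
      sgn k * (X zero j * Det (minor N k))
        ≈⟨ *-congˡ (*-congˡ (Det-shuffled-blocks ρ κ′ (minor N k) upper′ lower′)) ⟩
      sgn k * (X zero j * ((shuffleSign ρ * shuffleSign κ′) * (Det (leftBlock ρ κ′ (minor N k)) * Det (rightBlock ρ κ′ (minor N k)))))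
        ≈⟨ *-congˡ (*-congˡ (*-congˡ (*-cong (Det-cong (λ i i′ → reflexive (≡.cong (N (suc (embedˡ ρ i))) (punchIn-deleteˡ-embedˡ κ j i′))))
                                             (Det-cong (λ i i′ → reflexive (≡.cong (N (suc (embedʳ ρ i))) (punchIn-deleteˡ-embedʳ κ j i′))))))) ⟩
      sgn k * (X zero j * ((shuffleSign ρ * shuffleSign κ′) * (Det (minor X j) * Det Y)))
        ≈⟨ solve 6 (λ g x p v m y → g :* (x :* (p :* v :* (m :* y))) := (g :* v) :* (p :* y :* (x :* m))) refl
                   (sgn k) (X zero j) (shuffleSign ρ) (shuffleSign κ′) (Det (minor X j)) (Det Y) ⟩
      (sgn k * shuffleSign κ′) * (shuffleSign ρ * Det Y * (X zero j * Det (minor X j)))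
        ≈⟨ *-congʳ (sgn-embedˡ κ j) ⟩
      (sgn j * shuffleSign κ) * (shuffleSign ρ * Det Y * (X zero j * Det (minor X j)))
        ≈⟨ solve 6 (λ g k p y x m → (g :* k) :* (p :* y :* (x :* m)) := p :* k :* y :* (g :* (x :* m))) refl
                   (sgn j) (shuffleSign κ) (shuffleSign ρ) (Det Y) (X zero j) (Det (minor X j)) ⟩
      w * laplaceTerm Det X j ∎
      where
      k : Fin _
      k = embedˡ κ j
      κ′ : Shuffle _ _ _
      κ′ = deleteˡ κ j
      upper′ : ∀ i i′ → minor N k (embedˡ ρ i) (embedʳ κ′ i′) ≈ 0#
      upper′ i i′ = trans (reflexive (≡.cong (N (suc (embedˡ ρ i))) (punchIn-deleteˡ-embedʳ κ j i′))) (upper (suc i) i′)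
      lower′ : ∀ i i′ → minor N k (embedʳ ρ i) (embedˡ κ′ i′) ≈ 0#
      lower′ i i′ = trans (reflexive (≡.cong (N (suc (embedʳ ρ i))) (punchIn-deleteˡ-embedˡ κ j i′))) (lower i (punchIn j i′))
  Det-shuffled-blocks (right {a} ρ) κ N upper lower = begin
    Det N                                          ≈⟨ trans (Det-suc N) (∑-shuffle κ t) ⟩
    ∑ (λ j → t (embedˡ κ j)) + ∑ (λ j → t (embedʳ κ j)) ≈⟨ +-cong (∑-zero leftColumn) (∑-cong rightColumn) ⟩
    0# + ∑ (λ j → w * laplaceTerm Det Y j)         ≈⟨ trans (+-identityˡ _) (∑-*ˡ w _) ⟩
    w * ∑ (laplaceTerm Det Y)                      ≈⟨ *-congˡ (Det-suc Y) ⟨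
    w * Det Y
      ≈⟨ solve 5 (λ s p k x y → s :* p :* k :* x :* y := s :* p :* k :* (x :* y)) refl (sign a) (shuffleSign ρ) _ (Det X) (Det Y) ⟩
    (sign a * shuffleSign ρ * shuffleSign κ) * (Det X * Det Y)
      ≈⟨ *-congʳ (*-congʳ (sign-+ a (inversions ρ))) ⟨
    (shuffleSign (right ρ) * shuffleSign κ) * (Det X * Det Y) ∎
    where
    X : Matrix _
    X = leftBlock (right ρ) κ N
    Y : Matrix _
    Y = rightBlock (right ρ) κ N
    w : Carrier
    w = sign a * shuffleSign ρ * shuffleSign κ * Det X
    t : Fin _ → Carrier
    t = laplaceTerm Det N
    leftColumn : ∀ j → t (embedˡ κ j) ≈ 0#
    leftColumn j = trans (*-congˡ (trans (*-congʳ (lower zero j)) (zeroˡ _))) (zeroʳ _)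
    rightColumn : ∀ j → t (embedʳ κ j) ≈ w * laplaceTerm Det Y j
    rightColumn j = begin
      sgn k * (Y zero j * Det (minor N k))
        ≈⟨ *-congˡ (*-congˡ (Det-shuffled-blocks ρ κ′ (minor N k) upper′ lower′)) ⟩
      sgn k * (Y zero j * ((shuffleSign ρ * shuffleSign κ′) * (Det (leftBlock ρ κ′ (minor N k)) * Det (rightBlock ρ κ′ (minor N k)))))
        ≈⟨ *-congˡ (*-congˡ (*-congˡ (*-cong (Det-cong (λ i i′ → reflexive (≡.cong (N (suc (embedˡ ρ i))) (punchIn-deleteʳ-embedˡ κ j i′))))
                                             (Det-cong (λ i i′ → reflexive (≡.cong (N (suc (embedʳ ρ i))) (punchIn-deleteʳ-embedʳ κ j i′))))))) ⟩
      sgn k * (Y zero j * ((shuffleSign ρ * shuffleSign κ′) * (Det X * Det (minor Y j))))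
        ≈⟨ solve 6 (λ g y p v x m → g :* (y :* (p :* v :* (x :* m))) := (g :* v) :* (p :* x :* (y :* m))) refl
                   (sgn k) (Y zero j) (shuffleSign ρ) (shuffleSign κ′) (Det X) (Det (minor Y j)) ⟩
      (sgn k * shuffleSign κ′) * (shuffleSign ρ * Det X * (Y zero j * Det (minor Y j)))
        ≈⟨ *-congʳ (sgn-embedʳ κ j) ⟩
      (sgn j * sign a * shuffleSign κ) * (shuffleSign ρ * Det X * (Y zero j * Det (minor Y j)))
        ≈⟨ solve 7 (λ g s k p x y m → (g :* s :* k) :* (p :* x :* (y :* m)) := s :* p :* k :* x :* (g :* (y :* m))) refl
                   (sgn j) (sign a) (shuffleSign κ) (shuffleSign ρ) (Det X) (Y zero j) (Det (minor Y j)) ⟩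
      w * laplaceTerm Det Y j ∎
      where
      k : Fin _
      k = embedʳ κ j
      κ′ : Shuffle _ _ _
      κ′ = deleteʳ κ j
      upper′ : ∀ i i′ → minor N k (embedˡ ρ i) (embedʳ κ′ i′) ≈ 0#
      upper′ i i′ = trans (reflexive (≡.cong (N (suc (embedˡ ρ i))) (punchIn-deleteʳ-embedʳ κ j i′))) (upper i (punchIn j i′))
      lower′ : ∀ i i′ → minor N k (embedʳ ρ i) (embedˡ κ′ i′) ≈ 0#
      lower′ i i′ = trans (reflexive (≡.cong (N (suc (embedʳ ρ i))) (punchIn-deleteʳ-embedˡ κ j i′))) (lower (suc i) i′)

  Det-block-diagonal : ∀ {a b s} (σ : Shuffle a b s) (N : Matrix s) →
    (∀ i j → N (embedˡ σ i) (embedʳ σ j) ≈ 0#) → (∀ i j → N (embedʳ σ i) (embedˡ σ j) ≈ 0#) →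
    Det N ≈ Det (leftBlock σ σ N) * Det (rightBlock σ σ N)
  Det-block-diagonal σ N upper lower =
    trans (Det-shuffled-blocks σ σ N upper lower) (trans (*-congʳ (shuffleSign² σ)) (*-identityˡ _))

  butterfly : ∀ {n} → (Fin (n ℕ.* 2) → Carrier) → Fin n × Fin 2 → Carrier
  butterfly f (w , zero)     = f (copy₀ w) + f (copy₁ w)
  butterfly f (w , suc zero) = f (copy₀ w) - f (copy₁ w)

  -- Each of the 2n butterflies (c₀ , c₁) ↦ (c₀ + c₁ , c₀ − c₁) on the pairs of columns,
  -- then of rows, multiplies the determinant by −2 and leaves diag(2(A + B), 2(A − B)).
  Det-pair-blocks-scaled : ∀ n (M : Matrix (n ℕ.* 2)) (A B : Matrix n) →
    (∀ v w → M (copy₀ v) (copy₀ w) ≈ A v w) → (∀ v w → M (copy₁ v) (copy₁ w) ≈ A v w) →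
    (∀ v w → M (copy₀ v) (copy₁ w) ≈ B v w) → (∀ v w → M (copy₁ v) (copy₀ w) ≈ B v w) →
    (ℕ→R 4 ^ n) * Det M ≈ (ℕ→R 4 ^ n) * (Det (λ v w → A v w + B v w) * Det (λ v w → A v w - B v w))
  Det-pair-blocks-scaled n M A B a₀₀ a₁₁ b₀₁ b₁₀ = begin
    (ℕ→R 4 ^ n) * Det M              ≈⟨ *-congʳ (trans (^-cong n (solve 0 (con (+ 4) := (:- con (+ 2)) :* (:- con (+ 2))) refl)) (^-distrib-* _ _ n)) ⟩
    ((m2 ^ n) * (m2 ^ n)) * Det M     ≈⟨ *-assoc _ _ _ ⟩
    (m2 ^ n) * ((m2 ^ n) * Det M)     ≈⟨ *-congˡ (Det-butterfly-columns n M M₁ (λ i w → reflexive (M₁-copy i w zero)) (λ i w → reflexive (M₁-copy i w (suc zero)))) ⟨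
    (m2 ^ n) * Det M₁                 ≈⟨ Det-butterfly-rows n M₁ M₂ (λ j v → reflexive (M₂-copy v zero j)) (λ j v → reflexive (M₂-copy v (suc zero) j)) ⟨
    Det M₂                            ≈⟨ Det-block-diagonal (interleave n) M₂ upper lower ⟩
    Det X * Det Y                     ≈⟨ *-cong (trans (Det-cong sumBlock) (Det-*ˡ _ _)) (trans (Det-cong differenceBlock) (Det-*ˡ _ _)) ⟩
    ((ℕ→R 2 ^ n) * Det A+B) * ((ℕ→R 2 ^ n) * Det A-B)
      ≈⟨ solve 3 (λ t a b → (t :* a) :* (t :* b) := (t :* t) :* (a :* b)) refl (ℕ→R 2 ^ n) (Det A+B) (Det A-B) ⟩
    ((ℕ→R 2 ^ n) * (ℕ→R 2 ^ n)) * (Det A+B * Det A-B)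
      ≈⟨ *-congʳ (trans (^-cong n (solve 0 (con (+ 4) := con (+ 2) :* con (+ 2)) refl)) (^-distrib-* _ _ n)) ⟨
    (ℕ→R 4 ^ n) * (Det A+B * Det A-B) ∎
    where
    m2 : Carrier
    m2 = - ℕ→R 2
    A+B A-B : Matrix n
    A+B v w = A v w + B v w
    A-B v w = A v w - B v w
    M₁ M₂ X Y : Matrix _
    M₁ i j = butterfly (M i) (remQuot {n} 2 j)
    M₂ i j = butterfly (λ k → M₁ k j) (remQuot {n} 2 i)
    X = leftBlock (interleave n) (interleave n) M₂
    Y = rightBlock (interleave n) (interleave n) M₂
    M₁-copy : ∀ i w u → M₁ i (combine w u) ≡ butterfly (M i) (w , u)
    M₁-copy i w u = ≡.cong (butterfly (M i)) (Fin.remQuot-combine {n} {2} w u)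
    M₂-copy : ∀ v u j → M₂ (combine v u) j ≡ butterfly (λ k → M₁ k j) (v , u)
    M₂-copy v u j = ≡.cong (butterfly (λ k → M₁ k j)) (Fin.remQuot-combine {n} {2} v u)
    entry : ∀ v u w u′ → M₂ (combine v u) (combine w u′) ≡ butterfly (λ k → butterfly (M k) (w , u′)) (v , u)
    entry v u w u′ rewrite Fin.remQuot-combine {n} {2} v u | Fin.remQuot-combine {n} {2} w u′ = ≡.refl
    e₀₀ : ∀ v w → M₂ (copy₀ v) (copy₀ w) ≈ ℕ→R 2 * A+B v w
    e₀₀ v w = trans (reflexive (entry v zero w zero)) (trans (+-cong (+-cong (a₀₀ v w) (b₀₁ v w)) (+-cong (b₁₀ v w) (a₁₁ v w)))
      (solve 2 (λ a b → (a :+ b) :+ (b :+ a) := con (+ 2) :* (a :+ b)) refl (A v w) (B v w)))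
    e₀₁ : ∀ v w → M₂ (copy₀ v) (copy₁ w) ≈ 0#
    e₀₁ v w = trans (reflexive (entry v zero w (suc zero))) (trans (+-cong (+-cong (a₀₀ v w) (-‿cong (b₀₁ v w))) (+-cong (b₁₀ v w) (-‿cong (a₁₁ v w))))
      (solve 2 (λ a b → (a :- b) :+ (b :- a) := con (+ 0)) refl (A v w) (B v w)))
    e₁₀ : ∀ v w → M₂ (copy₁ v) (copy₀ w) ≈ 0#
    e₁₀ v w = trans (reflexive (entry v (suc zero) w zero)) (trans (+-cong (+-cong (a₀₀ v w) (b₀₁ v w)) (-‿cong (+-cong (b₁₀ v w) (a₁₁ v w))))
      (solve 2 (λ a b → (a :+ b) :- (b :+ a) := con (+ 0)) refl (A v w) (B v w)))
    e₁₁ : ∀ v w → M₂ (copy₁ v) (copy₁ w) ≈ ℕ→R 2 * A-B v w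
    e₁₁ v w = trans (reflexive (entry v (suc zero) w (suc zero))) (trans (+-cong (+-cong (a₀₀ v w) (-‿cong (b₀₁ v w))) (-‿cong (+-cong (b₁₀ v w) (-‿cong (a₁₁ v w)))))
      (solve 2 (λ a b → (a :- b) :- (b :- a) := con (+ 2) :* (a :- b)) refl (A v w) (B v w)))
    upper : ∀ i j → M₂ (embedˡ (interleave n) i) (embedʳ (interleave n) j) ≈ 0#
    upper i j rewrite embedˡ-interleave n i | embedʳ-interleave n j = e₀₁ i j
    lower : ∀ i j → M₂ (embedʳ (interleave n) i) (embedˡ (interleave n) j) ≈ 0#
    lower i j rewrite embedʳ-interleave n i | embedˡ-interleave n j = e₁₀ i j
    sumBlock : ∀ v w → X v w ≈ ℕ→R 2 * A+B v w
    sumBlock v w rewrite embedˡ-interleave n v | embedˡ-interleave n w = e₀₀ v w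
    differenceBlock : ∀ v w → Y v w ≈ ℕ→R 2 * A-B v w
    differenceBlock v w rewrite embedʳ-interleave n v | embedʳ-interleave n w = e₁₁ v w

  scalar : ∀ {n} → Carrier → Matrix n
  scalar y i j = if eqᵇ i j then y else 0#

  Det-first-column : ∀ {k} (M : Matrix (suc k)) → (∀ i → M (suc i) zero ≈ 0#) →
    Det M ≈ M zero zero * Det (minor M zero)
  Det-first-column M below = begin
    Det M                                    ≈⟨ Det-transpose M ⟨
    Det (M ᵀ)                                ≈⟨ trans (Det-suc (M ᵀ)) (∑-suc _) ⟩
    1# * (M zero zero * Det (minor (M ᵀ) zero)) + ∑ (λ j → laplaceTerm Det (M ᵀ) (suc j))
      ≈⟨ +-cong (*-identityˡ _) (∑-zero (λ j → trans (*-congˡ (trans (*-congʳ (below j)) (zeroˡ _))) (zeroʳ _))) ⟩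
    M zero zero * Det (minor M zero ᵀ) + 0#  ≈⟨ +-identityʳ _ ⟩
    M zero zero * Det (minor M zero ᵀ)       ≈⟨ *-congˡ (Det-transpose (minor M zero)) ⟩
    M zero zero * Det (minor M zero)         ∎

  Det-scalar-plus-rank-one : ∀ n (M : Matrix (suc n)) y (u : Fin (suc n) → Carrier) →
    (∀ i j → M i j ≈ scalar y i j + u i) → Det M ≈ (y ^ n) * (y + ∑ u)
  Det-scalar-plus-rank-one zero M y u entries = begin
    Det M          ≈⟨ Det₁ M ⟩
    M zero zero    ≈⟨ entries zero zero ⟩
    y + u zero     ≈⟨ +-congˡ (trans (∑-suc u) (trans (+-congˡ (∑-zero (λ ()))) (+-identityʳ _))) ⟨
    y + ∑ u        ≈⟨ *-identityˡ _ ⟨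
    1# * (y + ∑ u) ∎
  Det-scalar-plus-rank-one (suc k) M y u entries = begin
    Det M                                    ≈⟨ Det-add-next-column M N₁ zero (- 1#) N₁-off N₁-zero ⟨
    Det N₁                                   ≈⟨ Det-add-previous-row N₁ N₂ zero 1# N₂-off (λ _ → refl) ⟨
    Det N₂                                   ≈⟨ Det-first-column N₂ N₂-below ⟩
    N₂ zero zero * Det (minor N₂ zero)       ≈⟨ *-cong N₂-corner (Det-scalar-plus-rank-one k (minor N₂ zero) y u′ N₂-minor) ⟩
    y * ((y ^ k) * (y + ∑ u′))               ≈⟨ *-assoc _ _ _ ⟨
    (y * (y ^ k)) * (y + ∑ u′)               ≈⟨ *-congˡ (+-congˡ ∑u′≈∑u) ⟩
    (y * (y ^ k)) * (y + ∑ u)                ∎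
    where
    N₁ N₂ : Matrix (suc (suc k))
    N₁ i zero    = M i zero + (- 1#) * M i (suc zero)
    N₁ i (suc j) = M i (suc j)
    N₂ (suc zero)    j = N₁ (suc zero) j + 1# * N₁ zero j
    N₂ zero          j = N₁ zero j
    N₂ (suc (suc i)) j = N₁ (suc (suc i)) j
    N₁-off : ∀ i j → j ≢ zero → N₁ i j ≈ M i j
    N₁-off i zero    0≢0 = ⊥-elim (0≢0 ≡.refl)
    N₁-off i (suc j) _   = refl
    N₁-zero : ∀ i → N₁ i zero ≈ M i zero + (- 1#) * M i (suc zero)
    N₁-zero i = refl
    N₂-off : ∀ i j → i ≢ suc zero → N₂ i j ≈ N₁ i j
    N₂-off zero          j _   = refl
    N₂-off (suc zero)    j 1≢1 = ⊥-elim (1≢1 ≡.refl)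
    N₂-off (suc (suc i)) j _   = refl
    u′ : Fin (suc k) → Carrier
    u′ zero    = u zero + u (suc zero)
    u′ (suc r) = u (suc (suc r))
    ∑u′≈∑u : ∑ u′ ≈ ∑ u
    ∑u′≈∑u = begin
      ∑ u′                                               ≈⟨ ∑-suc u′ ⟩
      (u zero + u (suc zero)) + ∑ (λ r → u (suc (suc r))) ≈⟨ +-assoc _ _ _ ⟩
      u zero + (u (suc zero) + ∑ (λ r → u (suc (suc r)))) ≈⟨ +-congˡ (∑-suc (λ r → u (suc r))) ⟨
      u zero + ∑ (λ r → u (suc r))                        ≈⟨ ∑-suc u ⟨
      ∑ u                                                 ∎
    N₂-corner : N₂ zero zero ≈ y
    N₂-corner = begin
      M zero zero + (- 1#) * M zero (suc zero)   ≈⟨ +-cong (entries _ _) (*-congˡ (entries _ _)) ⟩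
      (y + u zero) + (- 1#) * (0# + u zero)      ≈⟨ solve 2 (λ y a → (y :+ a) :+ (:- con (+ 1)) :* (con (+ 0) :+ a) := y) refl y (u zero) ⟩
      y                                          ∎
    N₂-below : ∀ i → N₂ (suc i) zero ≈ 0#
    N₂-below zero = begin
      (M (suc zero) zero + (- 1#) * M (suc zero) (suc zero)) + 1# * (M zero zero + (- 1#) * M zero (suc zero))
        ≈⟨ +-cong (+-cong (entries _ _) (*-congˡ (entries _ _))) (*-congˡ (+-cong (entries _ _) (*-congˡ (entries _ _)))) ⟩
      ((0# + u (suc zero)) + (- 1#) * (y + u (suc zero))) + 1# * ((y + u zero) + (- 1#) * (0# + u zero))
        ≈⟨ solve 3 (λ y a b → ((con (+ 0) :+ b) :+ (:- con (+ 1)) :* (y :+ b)) :+ con (+ 1) :* ((y :+ a) :+ (:- con (+ 1)) :* (con (+ 0) :+ a)) := con (+ 0))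
                   refl y (u zero) (u (suc zero)) ⟩
      0# ∎
    N₂-below (suc i) = begin
      M (suc (suc i)) zero + (- 1#) * M (suc (suc i)) (suc zero) ≈⟨ +-cong (entries _ _) (*-congˡ (entries _ _)) ⟩
      (0# + u (suc (suc i))) + (- 1#) * (0# + u (suc (suc i)))
        ≈⟨ solve 1 (λ a → (con (+ 0) :+ a) :+ (:- con (+ 1)) :* (con (+ 0) :+ a) := con (+ 0)) refl (u (suc (suc i))) ⟩
      0# ∎
    N₂-minor : ∀ r s → minor N₂ zero r s ≈ scalar y r s + u′ r
    N₂-minor zero s = begin
      M (suc zero) (suc s) + 1# * M zero (suc s)             ≈⟨ +-cong (entries _ _) (*-congˡ (entries _ _)) ⟩
      (scalar y zero s + u (suc zero)) + 1# * (0# + u zero)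
        ≈⟨ solve 3 (λ d a b → (d :+ b) :+ con (+ 1) :* (con (+ 0) :+ a) := d :+ (a :+ b)) refl (scalar y zero s) (u zero) (u (suc zero)) ⟩
      scalar y zero s + (u zero + u (suc zero))              ∎
    N₂-minor (suc r) s = entries (suc (suc r)) (suc s)

  -- Polynomial functions

  eval : ∀ {k} → Vec Carrier k → Carrier → Carrier
  eval []       y = 0#
  eval (a ∷ as) y = a + y * eval as y

  IsPolynomial : ℕ → (Carrier → Carrier) → Set (c Level.⊔ ℓ)
  IsPolynomial k f = Σ[ as ∈ Vec Carrier k ] (∀ y → f y ≈ eval as y)

  IsPolynomial-cong : ∀ {k f g} → IsPolynomial k f → (∀ y → g y ≈ f y) → IsPolynomial k g
  IsPolynomial-cong (as , f≈) g≈f = as , (λ y → trans (g≈f y) (f≈ y))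

  IsPolynomial-zero : ∀ k → IsPolynomial k (λ _ → 0#)
  IsPolynomial-zero zero    = [] , (λ _ → refl)
  IsPolynomial-zero (suc k) with as , 0≈ ← IsPolynomial-zero k =
    0# ∷ as , (λ y → sym (trans (+-identityˡ _) (trans (*-congˡ (sym (0≈ y))) (zeroʳ y))))

  IsPolynomial-const : ∀ a → IsPolynomial 1 (λ _ → a)
  IsPolynomial-const a = a ∷ [] , (λ y → sym (trans (+-congˡ (zeroʳ y)) (+-identityʳ a)))

  IsPolynomial-+ : ∀ {k f g} → IsPolynomial k f → IsPolynomial k g → IsPolynomial k (λ y → f y + g y)
  IsPolynomial-+ (as , f≈) (bs , g≈) = zipWith _+_ as bs , λ y → trans (+-cong (f≈ y) (g≈ y)) (sym (eval-+ as bs y))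
    where
    eval-+ : ∀ {k} (as bs : Vec Carrier k) y → eval (zipWith _+_ as bs) y ≈ eval as y + eval bs y
    eval-+ []       []       y = sym (+-identityʳ 0#)
    eval-+ (a ∷ as) (b ∷ bs) y = trans (+-congˡ (*-congˡ (eval-+ as bs y)))
      (solve 5 (λ a b y p q → (a :+ b) :+ y :* (p :+ q) := (a :+ y :* p) :+ (b :+ y :* q)) refl a b y (eval as y) (eval bs y))

  IsPolynomial-*ˡ : ∀ {k f} t → IsPolynomial k f → IsPolynomial k (λ y → t * f y)
  IsPolynomial-*ˡ t (as , f≈) = map (t *_) as , λ y → trans (*-congˡ (f≈ y)) (sym (eval-* as y))
    where
    eval-* : ∀ {k} (as : Vec Carrier k) y → eval (map (t *_) as) y ≈ t * eval as y
    eval-* []       y = sym (zeroʳ t)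
    eval-* (a ∷ as) y = trans (+-congˡ (*-congˡ (eval-* as y)))
      (solve 4 (λ t a y p → t :* a :+ y :* (t :* p) := t :* (a :+ y :* p)) refl t a y (eval as y))

  IsPolynomial-raise : ∀ {k f} → IsPolynomial k f → IsPolynomial (suc k) f
  IsPolynomial-raise {zero}  ([] , f≈)     = IsPolynomial-cong (IsPolynomial-zero 1) f≈
  IsPolynomial-raise {suc k} (a ∷ as , f≈) with bs , g≈ ← IsPolynomial-raise (as , (λ _ → refl)) =
    a ∷ bs , (λ y → trans (f≈ y) (+-congˡ (*-congˡ (g≈ y))))

  IsPolynomial-affine-* : ∀ {k f} a b → IsPolynomial k f → IsPolynomial (suc k) (λ y → (a + b * y) * f y)
  IsPolynomial-affine-* {f = f} a b p@(as , f≈) =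
    IsPolynomial-cong (IsPolynomial-+ (IsPolynomial-*ˡ a (IsPolynomial-raise p)) (0# ∷ proj₁ (IsPolynomial-*ˡ b p) , λ _ → refl))
      (λ y → trans (solve 4 (λ a b y p → (a :+ b :* y) :* p := a :* p :+ (con (+ 0) :+ y :* (b :* p))) refl a b y (f y))
                   (+-congˡ (+-congˡ (*-congˡ (proj₂ (IsPolynomial-*ˡ b p) y)))))

  IsPolynomial-∑ : ∀ {k n} (f : Fin n → Carrier → Carrier) → (∀ i → IsPolynomial k (f i)) →
    IsPolynomial k (λ y → ∑ (λ i → f i y))
  IsPolynomial-∑ {k} {zero}  f _     = IsPolynomial-cong (IsPolynomial-zero k) (λ _ → ∑-zero (λ ()))
  IsPolynomial-∑ {k} {suc n} f polys =
    IsPolynomial-cong (IsPolynomial-+ (polys zero) (IsPolynomial-∑ (λ i → f (suc i)) (λ i → polys (suc i)))) (λ _ → ∑-suc _)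

  IsAffine : (Carrier → Carrier) → Set (c Level.⊔ ℓ)
  IsAffine f = Σ[ a ∈ Carrier ] Σ[ b ∈ Carrier ] (∀ y → f y ≈ a + b * y)

  IsPolynomial-Det : ∀ n (M : Carrier → Matrix n) → (∀ i j → IsAffine (λ y → M y i j)) →
    IsPolynomial (suc n) (λ y → Det (M y))
  IsPolynomial-Det zero    M _      = IsPolynomial-cong (IsPolynomial-const 1#) (λ y → Det-zero (M y))
  IsPolynomial-Det (suc n) M affine = IsPolynomial-cong (IsPolynomial-∑ _ term) (λ y → Det-suc (M y))
    where
    term : ∀ j → IsPolynomial (suc (suc n)) (λ y → laplaceTerm Det (M y) j)
    term j with a , b , M≈ ← affine zero j =
      IsPolynomial-*ˡ (sgn j) (IsPolynomial-cong
        (IsPolynomial-affine-* a b (IsPolynomial-Det n (λ y → minor (M y) j) (λ r s → affine (suc r) (punchIn j s))))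
        (λ y → *-congʳ (M≈ y)))

  IsPolynomial-Π : ∀ n (a : Fin n → Carrier) → IsPolynomial (suc n) (λ y → Π (λ r → y + a r))
  IsPolynomial-Π zero    a = IsPolynomial-const 1#
  IsPolynomial-Π (suc n) a = IsPolynomial-cong (IsPolynomial-affine-* (a zero) 1# (IsPolynomial-Π n (λ r → a (suc r))))
    (λ y → *-congʳ (trans (+-comm _ _) (+-congˡ (sym (*-identityˡ y)))))

  IsPolynomial-factor : ∀ {k f} → IsPolynomial (suc k) f → ∀ r →
    Σ[ q ∈ (Carrier → Carrier) ] (IsPolynomial k q × (∀ y → f y ≈ f r + (y - r) * q y))
  IsPolynomial-factor {zero}  {f} (a ∷ [] , f≈) r = (λ _ → 0#) , IsPolynomial-zero 0 , λ y → begin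
    f y                     ≈⟨ trans (f≈ y) (trans (+-congˡ (zeroʳ y)) (+-identityʳ a)) ⟩
    a                       ≈⟨ trans (f≈ r) (trans (+-congˡ (zeroʳ r)) (+-identityʳ a)) ⟨
    f r                     ≈⟨ trans (+-congˡ (zeroʳ _)) (+-identityʳ _) ⟨
    f r + (y - r) * 0#      ∎
  IsPolynomial-factor {suc k} {f} (a ∷ as , f≈) r
    with q , q-poly , g≈ ← IsPolynomial-factor (as , (λ _ → refl)) r =
    (λ y → eval as y + r * q y) , IsPolynomial-+ (as , (λ _ → refl)) (IsPolynomial-*ˡ r (IsPolynomial-raise q-poly)) , λ y → begin
      f y                                                   ≈⟨ trans (f≈ y) (+-congˡ (*-congˡ (g≈ y))) ⟩
      a + y * (eval as r + (y - r) * q y)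
        ≈⟨ solve 5 (λ a y r g q → a :+ y :* (g :+ (y :- r) :* q) := (a :+ r :* g) :+ (y :- r) :* ((g :+ (y :- r) :* q) :+ r :* q))
                   refl a y r (eval as r) (q y) ⟩
      (a + r * eval as r) + (y - r) * ((eval as r + (y - r) * q y) + r * q y)
        ≈⟨ +-cong (f≈ r) (*-congˡ (+-congʳ (g≈ y))) ⟨
      f r + (y - r) * (eval as y + r * q y)                 ∎

  -- Integral domains of characteristic zero

  module _ (noZeroDivisors : ∀ a b → a * b ≈ 0# → a ≈ 0# ⊎ b ≈ 0#) where

    IsPolynomial-vanishing : ∀ {k f} → IsPolynomial k f → (points : Fin k → Carrier) →
      (∀ i j → points i ≈ points j → i ≡ j) → (∀ i → f (points i) ≈ 0#) → ∀ y → f y ≈ 0#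
    IsPolynomial-vanishing {zero}      ([] , f≈) _ _ _ y = f≈ y
    IsPolynomial-vanishing {suc k} {f} poly points injective roots y
      with q , q-poly , f≈ ← IsPolynomial-factor poly (points zero) = begin
        f y                              ≈⟨ f≈ y ⟩
        f r + (y - r) * q y              ≈⟨ +-cong (roots zero) (*-congˡ (IsPolynomial-vanishing q-poly (points ∘ suc)
                                                                     (λ i j eq → Fin.suc-injective (injective _ _ eq)) q-roots y)) ⟩
        0# + (y - r) * 0#                ≈⟨ trans (+-identityˡ _) (zeroʳ _) ⟩
        0#                               ∎
      where
      r : Carrier
      r = points zero
      q-roots : ∀ i → q (points (suc i)) ≈ 0#
      q-roots i with noZeroDivisors (points (suc i) - r) (q (points (suc i))) product≈0
        where
        product≈0 : (points (suc i) - r) * q (points (suc i)) ≈ 0#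
        product≈0 = begin
          (points (suc i) - r) * q (points (suc i))           ≈⟨ +-identityˡ _ ⟨
          0# + (points (suc i) - r) * q (points (suc i))      ≈⟨ +-congʳ (roots zero) ⟨
          f r + (points (suc i) - r) * q (points (suc i))     ≈⟨ f≈ _ ⟨
          f (points (suc i))                                  ≈⟨ roots (suc i) ⟩
          0#                                                  ∎
      ... | inj₁ difference≈0 = case injective (suc i) zero (x∙y⁻¹≈ε⇒x≈y _ _ difference≈0) of λ ()
      ... | inj₂ q≈0          = q≈0

    *-cancelˡ-nonzero : ∀ {t x y} → ¬ t ≈ 0# → t * x ≈ t * y → x ≈ y
    *-cancelˡ-nonzero {t} {x} {y} t≉0 tx≈ty with noZeroDivisors t (x - y) t[x-y]≈0
      where
      t[x-y]≈0 : t * (x - y) ≈ 0#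
      t[x-y]≈0 = begin
        t * (x - y)     ≈⟨ solve 3 (λ t x y → t :* (x :- y) := t :* x :- t :* y) refl t x y ⟩
        t * x - t * y   ≈⟨ +-congʳ tx≈ty ⟩
        t * y - t * y   ≈⟨ -‿inverseʳ _ ⟩
        0#              ∎
    ... | inj₁ t≈0   = ⊥-elim (t≉0 t≈0)
    ... | inj₂ x-y≈0 = x∙y⁻¹≈ε⇒x≈y x y x-y≈0

    module _ (charZero : ∀ k → ¬ fromℕ (suc k) ≈ 0#) where

      ℕ→R-suc-nonzero : ∀ k → ¬ ℕ→R (suc k) ≈ 0#
      ℕ→R-suc-nonzero k eq = charZero k (trans (sym (ℕ→R≈fromℕ (suc k))) eq)

      ^-nonzero : ∀ {t} n → ¬ t ≈ 0# → ¬ (t ^ n) ≈ 0#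
      ^-nonzero zero    t≉0 = ℕ→R-suc-nonzero 0
      ^-nonzero (suc n) t≉0 tⁿ⁺¹≈0 with noZeroDivisors _ _ tⁿ⁺¹≈0
      ... | inj₁ t≈0  = t≉0 t≈0
      ... | inj₂ tⁿ≈0 = ^-nonzero n t≉0 tⁿ≈0

      ℕ→R-injective : ∀ m n → ℕ→R m ≈ ℕ→R n → m ≡ n
      ℕ→R-injective zero    zero    _  = ≡.refl
      ℕ→R-injective zero    (suc n) eq = ⊥-elim (ℕ→R-suc-nonzero n (sym eq))
      ℕ→R-injective (suc m) zero    eq = ⊥-elim (ℕ→R-suc-nonzero m eq)
      ℕ→R-injective (suc m) (suc n) eq = ≡.cong suc (ℕ→R-injective m n
        (+-cancelˡ 1# _ _ (trans (sym (ℕ→R-suc m)) (trans eq (ℕ→R-suc n)))))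

      -- Both sides are polynomials of degree n in y; at y = −t·k both equal (−t)ⁿ χ_D(k).
      Det-scalar+scaled : ∀ {n} (D : Matrix n) (∂ : Fin n → Carrier) t → ¬ t ≈ 0# →
        (∀ z → Det (λ v w → scalar z v w - D v w) ≈ Π (λ r → z - ∂ r)) →
        ∀ y → Det (λ v w → scalar y v w + t * D v w) ≈ Π (λ r → y + t * ∂ r)
      Det-scalar+scaled {n} D ∂ t t≉0 eigenvalues y =
        x∙y⁻¹≈ε⇒x≈y _ _ (trans (+-congˡ (sym (-1*x≈-x _))) (IsPolynomial-vanishing difference points injective roots y))
        where
        F G : Carrier → Carrier
        F y = Det (λ v w → scalar y v w + t * D v w)
        G y = Π (λ r → y + t * ∂ r)
        affine : ∀ v w → IsAffine (λ y → scalar y v w + t * D v w)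
        affine v w with eqᵇ v w
        ... | true  = t * D v w , 1# , λ y → trans (+-comm _ _) (+-congˡ (sym (*-identityˡ y)))
        ... | false = t * D v w , 0# , λ y → trans (+-comm _ _) (+-congˡ (sym (zeroˡ y)))
        difference : IsPolynomial (suc n) (λ y → F y + (- 1#) * G y)
        difference = IsPolynomial-+ (IsPolynomial-Det n _ affine) (IsPolynomial-*ˡ (- 1#) (IsPolynomial-Π n _))
        F-scaled : ∀ z → F (- (t * z)) ≈ ((- t) ^ n) * Π (λ r → z - ∂ r)
        F-scaled z = begin
          F (- (t * z))                                   ≈⟨ Det-cong entry ⟩
          Det (λ v w → (- t) * (scalar z v w - D v w))    ≈⟨ Det-*ˡ (- t) _ ⟩
          ((- t) ^ n) * Det (λ v w → scalar z v w - D v w) ≈⟨ *-congˡ (eigenvalues z) ⟩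
          ((- t) ^ n) * Π (λ r → z - ∂ r)                 ∎
          where
          entry : ∀ v w → scalar (- (t * z)) v w + t * D v w ≈ (- t) * (scalar z v w - D v w)
          entry v w with eqᵇ v w
          ... | true  = solve 3 (λ t z d → :- (t :* z) :+ t :* d := (:- t) :* (z :- d)) refl t z (D v w)
          ... | false = solve 2 (λ t d → con (+ 0) :+ t :* d := (:- t) :* (con (+ 0) :- d)) refl t (D v w)
        G-scaled : ∀ z → G (- (t * z)) ≈ ((- t) ^ n) * Π (λ r → z - ∂ r)
        G-scaled z = trans (Π-cong (λ r → solve 3 (λ t z d → :- (t :* z) :+ t :* d := (:- t) :* (z :- d)) refl t z (∂ r)))
                           (Π-*ˡ (- t) (λ r → z - ∂ r))
        points : Fin (suc n) → Carrier
        points i = - (t * ℕ→R (toℕ i))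
        roots : ∀ i → F (points i) + (- 1#) * G (points i) ≈ 0#
        roots i = begin
          F (points i) + (- 1#) * G (points i)  ≈⟨ +-cong (F-scaled _) (*-congˡ (G-scaled _)) ⟩
          X + (- 1#) * X                        ≈⟨ solve 1 (λ x → x :+ (:- con (+ 1)) :* x := con (+ 0)) refl X ⟩
          0#                                    ∎
          where
          X : Carrier
          X = ((- t) ^ n) * Π (λ r → ℕ→R (toℕ i) - ∂ r)
        injective : ∀ i j → points i ≈ points j → i ≡ j
        injective i j eq = Fin.toℕ-injective (ℕ→R-injective _ _ (*-cancelˡ-nonzero t≉0 (-‿injective eq)))

      Det-pair-blocks : ∀ n (M : Matrix (n ℕ.* 2)) (A B : Matrix n) →
        (∀ v w → M (copy₀ v) (copy₀ w) ≈ A v w) → (∀ v w → M (copy₁ v) (copy₁ w) ≈ A v w) →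
        (∀ v w → M (copy₀ v) (copy₁ w) ≈ B v w) → (∀ v w → M (copy₁ v) (copy₀ w) ≈ B v w) →
        Det M ≈ Det (λ v w → A v w + B v w) * Det (λ v w → A v w - B v w)
      Det-pair-blocks n M A B a₀₀ a₁₁ b₀₁ b₁₀ =
        *-cancelˡ-nonzero (^-nonzero n (ℕ→R-suc-nonzero 3)) (Det-pair-blocks-scaled n M A B a₀₀ a₁₁ b₀₁ b₁₀)

      charPoly-distSeidel-□K₂ : ∀ {n} {G : Graph n} {d dP} → IsDistanceFn G d → IsDistanceFn (G □ K₂) dP → ∀ x →
        charPoly (distSeidel dP) x ≈
          Det (λ v w → scalar (x + 1#) v w + ℕ→R 4 * distMatrix d v w) * Det (λ v w → scalar (x + 1#) v w + - ℕ→R 2)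
      charPoly-distSeidel-□K₂ {n} {G} {d} {dP} isDistance isDistanceP x = begin
        charPoly (distSeidel dP) x                ≡⟨ Det≡det M ⟨
        Det M                                     ≈⟨ Det-pair-blocks n M A B a₀₀ a₁₁ b₀₁ b₁₀ ⟩
        Det (λ v w → A v w + B v w) * Det (λ v w → A v w - B v w)
          ≈⟨ *-cong (Det-cong sum) (Det-cong difference) ⟩
        Det (λ v w → scalar (x + 1#) v w + ℕ→R 4 * distMatrix d v w) * Det (λ v w → scalar (x + 1#) v w + - ℕ→R 2) ∎
        where
        entry : Bool → ℕ → Carrier
        entry b k = (if b then x else 0#) - ((if b then 0# else 1#) - fromℕ 2 * fromℕ k)
        M : Matrix (n ℕ.* 2)
        M p q = entry (eqᵇ p q) (dP p q)
        A B : Matrix n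
        A v w = entry (eqᵇ v w) (d v w)
        B v w = entry false (suc (d v w))
        M-copy : ∀ v u w u′ → M (combine v u) (combine w u′) ≡ entry (eqᵇ v w ∧ eqᵇ u u′) (d v w ℕ.+ crossing u u′)
        M-copy v u w u′ = ≡.cong₂ entry (eqᵇ-combine v w u u′) (distance-□K₂ G isDistance isDistanceP v u w u′)
        a₀₀ : ∀ v w → M (copy₀ v) (copy₀ w) ≈ A v w
        a₀₀ v w = reflexive (≡.trans (M-copy v zero w zero) (≡.cong₂ entry (Bool.∧-identityʳ (eqᵇ v w)) (ℕ.+-identityʳ (d v w))))
        a₁₁ : ∀ v w → M (copy₁ v) (copy₁ w) ≈ A v w
        a₁₁ v w = reflexive (≡.trans (M-copy v (suc zero) w (suc zero)) (≡.cong₂ entry (Bool.∧-identityʳ (eqᵇ v w)) (ℕ.+-identityʳ (d v w))))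
        b₀₁ : ∀ v w → M (copy₀ v) (copy₁ w) ≈ B v w
        b₀₁ v w = reflexive (≡.trans (M-copy v zero w (suc zero)) (≡.cong₂ entry (Bool.∧-zeroʳ _) (ℕ.+-comm (d v w) 1)))
        b₁₀ : ∀ v w → M (copy₁ v) (copy₀ w) ≈ B v w
        b₁₀ v w = reflexive (≡.trans (M-copy v (suc zero) w zero) (≡.cong₂ entry (Bool.∧-zeroʳ _) (ℕ.+-comm (d v w) 1)))
        sum : ∀ v w → A v w + B v w ≈ scalar (x + 1#) v w + ℕ→R 4 * distMatrix d v w
        sum v w with eqᵇ v w
        ... | true  = solve 2 (λ x k → (x :- (con (+ 0) :- ‵fromℕ 2 :* k)) :+ (con (+ 0) :- (con (+ 1) :- ‵fromℕ 2 :* (con (+ 1) :+ k)))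
                                     := (x :+ con (+ 1)) :+ con (+ 4) :* k) refl x (fromℕ (d v w))
        ... | false = solve 1 (λ k → (con (+ 0) :- (con (+ 1) :- ‵fromℕ 2 :* k)) :+ (con (+ 0) :- (con (+ 1) :- ‵fromℕ 2 :* (con (+ 1) :+ k)))
                                     := con (+ 0) :+ con (+ 4) :* k) refl (fromℕ (d v w))
        difference : ∀ v w → A v w - B v w ≈ scalar (x + 1#) v w + - ℕ→R 2
        difference v w with eqᵇ v w
        ... | true  = solve 2 (λ x k → (x :- (con (+ 0) :- ‵fromℕ 2 :* k)) :- (con (+ 0) :- (con (+ 1) :- ‵fromℕ 2 :* (con (+ 1) :+ k)))
                                     := (x :+ con (+ 1)) :+ (:- con (+ 2))) refl x (fromℕ (d v w))
        ... | false = solve 1 (λ k → (con (+ 0) :- (con (+ 1) :- ‵fromℕ 2 :* k)) :- (con (+ 0) :- (con (+ 1) :- ‵fromℕ 2 :* (con (+ 1) :+ k)))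
                                     := con (+ 0) :+ (:- con (+ 2))) refl (fromℕ (d v w))

theorem6p4 : ∀ {c ℓ : Level} (R : CommutativeRing c ℓ) → LinAlg.IsCharZeroDomain R →
    ∀ (n : ℕ) → 1 ≤ n → (G : Graph n) → Connected G →
    (d : Fin n → Fin n → ℕ) → IsDistanceFn G d → DistanceRegular G d →
    (dP : Fin (n ℕ.* 2) → Fin (n ℕ.* 2) → ℕ) → IsDistanceFn (G □ K₂) dP →
    (∂ : Fin n → CommutativeRing.Carrier R) →
    LinAlg.HasEigenvalues R (LinAlg.distMatrix R d) ∂ →
    let open CommutativeRing R
        open LinAlg R
    in ∀ x → charPoly (distSeidel dP) x
         ≈ (x - (fromℕ (2 ℕ.* n) - 1#)) * ((x - (- 1#)) ^ (n ∸ 1))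
             * Π (λ r → x - (- 1# - fromℕ 4 * ∂ r))
theorem6p4 R (_ , noZeroDivisors , charZero) (suc n) _ G _ d isDistance _ dP isDistanceP ∂ eigenvalues x = begin
  charPoly (distSeidel dP) x
    ≈⟨ charPoly-distSeidel-□K₂ noZeroDivisors charZero isDistance isDistanceP x ⟩
  Det (λ v w → scalar y v w + ℕ→R 4 * distMatrix d v w) * Det (λ v w → scalar y v w + - ℕ→R 2)
    ≈⟨ *-cong (Det-scalar+scaled noZeroDivisors charZero (distMatrix d) ∂ (ℕ→R 4) (ℕ→R-suc-nonzero noZeroDivisors charZero 3)
                (λ z → trans (reflexive (Det≡det _)) (eigenvalues z)) y)
              (Det-scalar-plus-rank-one n _ y (λ _ → - ℕ→R 2) (λ _ _ → refl)) ⟩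
  Π (λ r → y + ℕ→R 4 * ∂ r) * ((y ^ n) * (y + ∑ (λ _ → - ℕ→R 2)))
    ≈⟨ *-cong (Π-cong (λ r → solve 2 (λ x e → (x :+ con (+ 1)) :+ con (+ 4) :* e := x :- ((:- con (+ 1)) :- ‵fromℕ 4 :* e)) refl x (∂ r)))
              (*-cong (^-cong n (solve 1 (λ x → x :+ con (+ 1) := x :- (:- con (+ 1))) refl x)) simple-eigenvalue) ⟩
  Π (λ r → x - (- 1# - fromℕ 4 * ∂ r)) * (((x - (- 1#)) ^ n) * (x - (fromℕ (2 ℕ.* suc n) - 1#)))
    ≈⟨ solve 3 (λ p q r → p :* (q :* r) := r :* q :* p) refl _ _ _ ⟩
  (x - (fromℕ (2 ℕ.* suc n) - 1#)) * ((x - (- 1#)) ^ n) * Π (λ r → x - (- 1# - fromℕ 4 * ∂ r)) ∎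
  where
  open CommutativeRing R
  open LinAlg R using (fromℕ; Π; _^_; distSeidel; distMatrix; charPoly)
  open Determinant R
  open import Relation.Binary.Reasoning.Setoid setoid
  y : Carrier
  y = x + 1#
  simple-eigenvalue : y + ∑ {suc n} (λ _ → - ℕ→R 2) ≈ x - (fromℕ (2 ℕ.* suc n) - 1#)
  simple-eigenvalue = begin
    y + ∑ {suc n} (λ _ → - ℕ→R 2)            ≈⟨ +-congˡ (∑-const (suc n) _) ⟩
    (x + 1#) + fromℕ (suc n) * (- ℕ→R 2)      ≈⟨ solve 2 (λ x m → (x :+ con (+ 1)) :+ m :* (:- con (+ 2)) := x :- (con (+ 2) :* m :- con (+ 1))) refl x _ ⟩
    x - (ℕ→R 2 * fromℕ (suc n) - 1#)          ≈⟨ +-congˡ (-‿cong (+-congʳ fromℕ-2*)) ⟩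
    x - (fromℕ (2 ℕ.* suc n) - 1#)            ∎
    where
    fromℕ-2* : ℕ→R 2 * fromℕ (suc n) ≈ fromℕ (2 ℕ.* suc n)
    fromℕ-2* = trans (*-congˡ (sym (ℕ→R≈fromℕ (suc n)))) (trans (sym (ℕ→R-* 2 (suc n))) (ℕ→R≈fromℕ (2 ℕ.* suc n)))
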